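{- Let $p$ be an odd prime, $m\ge1$ and $n=p^m$. Then the distance spectrum of the unitary addition Cayley graph $G_n$ consists of the eigenvalues $-1-p^{m-1}$ with multiplicity $\frac{p-1}{2}$; $-2$ with multiplicity $p^{m-1}-1$; $-1$ with multiplicity $(p-1)(p^{m-1}-1)$; $\frac{x_2-y_2}{2}$ with multiplicity $1$; $p^{m-1}-1$ with multiplicity $\frac{p-3}{2}$; and $\frac{x_2+y_2}{2}$ with multiplicity $1$, where $x_2=p^m+2p^{m-1}-3$ and $y_2=\sqrt{p^{2m}+2p^m-4p^{m-1}+1}$.
   Context: For an integer $n>1$, the unitary addition Cayley graph $G_n$ is the simple graph with vertex set $\mathbb{Z}_n$ in which distinct vertices $a,b$ are adjacent iff $a+b\in U_n$, the group of units of $\mathbb{Z}_n$. The distance matrix $D$ of a connected graph has $(i,j)$ entry the graph distance $d(v_i,v_j)$; its eigenvalues form the distance spectrum. A multiplicity $0$ means the value does not occur. -}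

module Defs where

open import Data.Bool using (Bool; true; false; _∧_; _∨_; not; if_then_else_)
open import Data.Nat as ℕ using (ℕ; zero; suc)
open import Data.Nat.DivMod using (_%_)
open import Data.Nat.GCD using (gcd)
open import Data.Fin as Fin using (Fin; zero; suc; toℕ; punchIn)
open import Data.Fin.Properties using () renaming (_≟_ to _≟ᶠ_)
open import Data.Integer as ℤ using (ℤ; +_; -_)
open import Relation.Nullary.Decidable using (⌊_⌋)

-- Unitary addition Cayley graph G_n on ℤ_n (vertices = Fin n, read as
-- residues 0..n-1).

isUnit : ℕ → ℕ → Bool
isUnit zero    s = false
isUnit (suc k) s = ⌊ gcd (s % suc k) (suc k) ℕ.≟ 1 ⌋

adj : (n : ℕ) → Fin n → Fin n → Bool
adj n a b = not ⌊ a ≟ᶠ b ⌋ ∧ isUnit n (toℕ a ℕ.+ toℕ b)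

anyFin : (n : ℕ) → (Fin n → Bool) → Bool
anyFin zero    f = false
anyFin (suc n) f = f zero ∨ anyFin n (λ i → f (suc i))

reach : (n : ℕ) → ℕ → Fin n → Fin n → Bool
reach n zero    a b = ⌊ a ≟ᶠ b ⌋
reach n (suc k) a b = reach n k a b ∨ anyFin n (λ c → reach n k a c ∧ adj n c b)

leastFrom : (n : ℕ) → Fin n → Fin n → ℕ → ℕ → ℕ
leastFrom n a b k zero      = k
leastFrom n a b k (suc fuel) = if reach n k a b then k else leastFrom n a b (suc k) fuel

-- graph distance d(a,b) in G_n: the least length of a walk from a to b.
-- (Any shortest path has length < n; G_n is connected in the theorem's
-- setting, so the fallback value n is never used there.)
dist : (n : ℕ) → Fin n → Fin n → ℕ
dist n a b = leastFrom n a b 0 n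

distMatrix : (n : ℕ) → Fin n → Fin n → ℤ
distMatrix n a b = + dist n a b

sumFin : (n : ℕ) → (Fin n → ℤ) → ℤ
sumFin zero    f = + 0
sumFin (suc n) f = f zero ℤ.+ sumFin n (λ i → f (suc i))

sign : ℕ → ℤ
sign zero          = + 1
sign (suc zero)    = - + 1
sign (suc (suc k)) = sign k

det : (n : ℕ) → (Fin n → Fin n → ℤ) → ℤ
det zero    M = + 1
det (suc n) M =
  sumFin (suc n) (λ j → sign (toℕ j) ℤ.* M zero j ℤ.* det n (λ i k → M (suc i) (punchIn j k)))

charPolyAt : (n : ℕ) → (Fin n → Fin n → ℤ) → ℤ → ℤ
charPolyAt n M t = det n (λ i j → (if ⌊ i ≟ᶠ j ⌋ then t else + 0) ℤ.- M i j)

{-# OPTIONS --safe #-}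
-- For a ≠ b the distance between a and b in G_(p^m) is 1 when p ∤ a + b and 2 otherwise, because one
-- of c = 0, 1, 2 is always a common neighbour. Hence t I − D = diag α − (d (a + b))_(a,b), where
-- d z ∈ {1, 2} depends only on z mod p and α a = t + d (2 a). Everything then follows from one
-- elementary step: if, for the last index k and some s < k, row k minus row s equals β (e_k − e_s),
-- then the determinant is β times that of the matrix with index k deleted and column k added to column s.
-- Peeling every index j + p against j folds the q = p^(m − 1) copies of each residue class together and
-- contributes ∏ α = (t + 2)^(q − 1) (t + 1)^((p − 1)(q − 1)). In the remaining p × p matrix, peeling
-- p − s against s for 1 ≤ s ≤ (p − 1)/2 contributes (t + 1 + q)^((p − 1)/2), then peeling 2, …, (p − 1)/2
-- against 1 contributes (t + 1 − q)^((p − 3)/2), and the last 2 × 2 determinant is the quadratic factor.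
module Submission where

open import Defs
open import Data.Nat as ℕ using (ℕ; zero; suc; _≤_; _<_; _≥_; _∸_; z≤n; s≤s)
import Data.Nat.Properties as ℕP
import Data.Nat.Tactic.RingSolver as ℕSolver
open import Data.Nat.DivMod using (_%_; _/_; m<n⇒m/n≡0; +-distrib-/-∣ʳ; n/n≡1; m<n*o⇒m/o<n; m*n/n≡m; /-monoˡ-≤)
open import Data.Nat.Divisibility
  using (_∣_; _∣?_; divides; ∣m+n∣m⇒∣n; ∣m∣n⇒∣m+n; n∣n; ∣-trans; %-presˡ-∣; ∣n∣m%n⇒∣m; ∣1⇒≡1; ∣⇒≤)
open import Data.Nat.GCD using (gcd; gcd[m,n]∣m; gcd[m,n]∣n; gcd-greatest)
open import Data.Nat.Primality using (Prime; prime⇒irreducible; ¬prime[1])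
open import Data.Nat.Coprimality using (Coprime; coprime-divisor)
open import Data.Fin using (Fin; zero; suc; toℕ; punchIn; punchOut; inject₁; fromℕ; fromℕ<)
open import Data.Fin.Properties
  using (punchInᵢ≢i; punchIn-punchOut; punchIn-injective; suc-injective; toℕ-inject₁; toℕ-injective;
         fromℕ≢inject₁; inject₁-injective; toℕ<n; toℕ-fromℕ; toℕ-fromℕ<)
  renaming (_≟_ to _≟ᶠ_)
open import Data.Integer as ℤ using (ℤ; +_; -_; _+_; _-_; _*_; _^_; 0ℤ; 1ℤ; -1ℤ)
import Data.Integer.Properties as ℤP
open import Data.Integer.Tactic.RingSolver using (solve-∀)
open import Algebra.Properties.Semiring.Sum ℤP.+-*-semiring
  using (sum; sum-syntax; ∑-distrib-+; ∑-comm; *-distribˡ-sum; sum-remove; sum-init-last; sum-cong-≗; sum-replicate-zero)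
open import Data.Bool using (Bool; true; false; _∧_; _∨_; if_then_else_)
open import Data.Bool.Properties using (∨-zeroʳ; ∧-zeroʳ)
open import Data.Vec.Functional using (updateAt)
open import Data.Vec.Functional.Properties using (updateAt-updates; updateAt-minimal)
open import Data.Product using (Σ; _,_; _×_; proj₁; proj₂)
open import Data.Sum using (_⊎_; inj₁; inj₂)
open import Data.Empty using (⊥; ⊥-elim)
open import Function using (_∘_)
open import Relation.Binary.PropositionalEquality
open import Relation.Binary.Definitions using (tri<; tri≈; tri>)
open import Relation.Nullary using (¬_; yes; no; Dec)
open import Relation.Nullary.Decidable using (⌊_⌋)

-- Determinants

sumFin≡sum : ∀ n (f : Fin n → ℤ) → sumFin n f ≡ sum f
sumFin≡sum zero    f = refl
sumFin≡sum (suc n) f = cong (λ s → f zero + s) (sumFin≡sum n (f ∘ suc))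

sum-zero : ∀ {n} (f : Fin n → ℤ) → (∀ i → f i ≡ 0ℤ) → sum f ≡ 0ℤ
sum-zero {n} f f≡0 = trans (sum-cong-≗ f≡0) (sum-replicate-zero n)

sum-neg : ∀ {n} (f : Fin n → ℤ) → sum (λ i → - f i) ≡ - sum f
sum-neg f = begin
  sum (λ i → - f i)        ≡⟨ sum-cong-≗ (λ i → sym (ℤP.-1*i≡-i (f i))) ⟩
  sum (λ i → -1ℤ * f i)    ≡⟨ *-distribˡ-sum -1ℤ f ⟨
  -1ℤ * sum f              ≡⟨ ℤP.-1*i≡-i (sum f) ⟩
  - sum f                  ∎
  where open ≡-Reasoning

sum-single : ∀ {n} (f : Fin (suc n) → ℤ) (a : Fin (suc n)) → (∀ j → j ≢ a → f j ≡ 0ℤ) → sum f ≡ f a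
sum-single f a f≡0 = begin
  sum f                             ≡⟨ sum-remove {i = a} f ⟩
  f a + sum (λ j → f (punchIn a j)) ≡⟨ cong (λ s → f a + s) (sum-zero _ (λ j → f≡0 _ (punchInᵢ≢i a j))) ⟩
  f a + 0ℤ                          ≡⟨ ℤP.+-identityʳ (f a) ⟩
  f a                               ∎
  where open ≡-Reasoning

sum-linear : ∀ {n} (a b : ℤ) {F G H : Fin n → ℤ} → (∀ j → F j ≡ a * G j + b * H j) →
  sum F ≡ a * sum G + b * sum H
sum-linear a b {F} {G} {H} F≡ = begin
  sum F                                    ≡⟨ sum-cong-≗ F≡ ⟩
  sum (λ j → a * G j + b * H j)            ≡⟨ ∑-distrib-+ (λ j → a * G j) (λ j → b * H j) ⟩
  sum (λ j → a * G j) + sum (λ j → b * H j) ≡⟨ cong₂ _+_ (*-distribˡ-sum a G) (*-distribˡ-sum b H) ⟨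
  a * sum G + b * sum H                    ∎
  where open ≡-Reasoning

sum-scale : ∀ {n} (c : ℤ) {F G : Fin n → ℤ} → (∀ j → F j ≡ c * G j) → sum F ≡ c * sum G
sum-scale c {G = G} F≡ = trans (sum-cong-≗ F≡) (sym (*-distribˡ-sum c G))

sum-antisym : ∀ {n} (f : Fin n → Fin n → ℤ) → (∀ a b → f a b ≡ - f b a) →
  ∑[ a < n ] ∑[ b < n ] f a b ≡ 0ℤ
sum-antisym {n} f anti = x≡-x⇒x≡0 (begin
  ∑[ a < n ] ∑[ b < n ] f a b      ≡⟨ ∑-comm f ⟩
  ∑[ b < n ] ∑[ a < n ] f a b      ≡⟨ sum-cong-≗ (λ b → sum-cong-≗ (λ a → anti a b)) ⟩
  ∑[ b < n ] ∑[ a < n ] (- f b a)  ≡⟨ sum-cong-≗ (λ b → sum-neg (f b)) ⟩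
  ∑[ b < n ] (- ∑[ a < n ] f b a)  ≡⟨ sum-neg (λ b → sum (f b)) ⟩
  - (∑[ b < n ] ∑[ a < n ] f b a)  ∎)
  where
  open ≡-Reasoning
  x≡-x⇒x≡0 : ∀ {x} → x ≡ - x → x ≡ 0ℤ
  x≡-x⇒x≡0 {+ zero}  _ = refl
  x≡-x⇒x≡0 {+ suc _} ()
  x≡-x⇒x≡0 {ℤ.-[1+ _ ]} ()

δℕ : ℕ → ℕ → ℤ
δℕ a b = if ⌊ a ℕ.≟ b ⌋ then 1ℤ else 0ℤ

δℕ-refl : ∀ a → δℕ a a ≡ 1ℤ
δℕ-refl a with a ℕ.≟ a
... | yes _  = refl
... | no a≢a = ⊥-elim (a≢a refl)

δℕ-≢ : ∀ {a b} → a ≢ b → δℕ a b ≡ 0ℤ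
δℕ-≢ {a} {b} a≢b with a ℕ.≟ b
... | yes a≡b = ⊥-elim (a≢b a≡b)
... | no _    = refl

δℕ-suc : ∀ a b → δℕ (suc a) (suc b) ≡ δℕ a b
δℕ-suc a b with a ℕ.≟ b
... | yes refl = δℕ-refl (suc a)
... | no a≢b   = δℕ-≢ (a≢b ∘ ℕP.suc-injective)

δ : ∀ {n} → Fin n → Fin n → ℤ
δ a b = δℕ (toℕ a) (toℕ b)

δ-refl : ∀ {n} (a : Fin n) → δ a a ≡ 1ℤ
δ-refl a = δℕ-refl (toℕ a)

δ-≢ : ∀ {n} {a b : Fin n} → a ≢ b → δ a b ≡ 0ℤ
δ-≢ a≢b = δℕ-≢ (a≢b ∘ toℕ-injective)

δ-punchIn : ∀ {n} (a : Fin (suc n)) (x y : Fin n) → δ (punchIn a x) (punchIn a y) ≡ δ x y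
δ-punchIn a x y with x ≟ᶠ y
... | yes refl = trans (δ-refl (punchIn a x)) (sym (δ-refl x))
... | no x≢y   = trans (δ-≢ (x≢y ∘ punchIn-injective a x y)) (sym (δ-≢ x≢y))

sum-*δ : ∀ {n} (u : Fin n → ℤ) (x : Fin n) → ∑[ b < n ] (u b * δ b x) ≡ u x
sum-*δ {suc n} u x = begin
  ∑[ b < suc n ] (u b * δ b x) ≡⟨ sum-single _ x (λ b b≢x → trans (cong (u b *_) (δ-≢ b≢x)) (ℤP.*-zeroʳ (u b))) ⟩
  u x * δ x x                  ≡⟨ cong (u x *_) (δ-refl x) ⟩
  u x * 1ℤ                     ≡⟨ ℤP.*-identityʳ (u x) ⟩
  u x                          ∎
  where open ≡-Reasoning

Matrix : ℕ → Set
Matrix n = Fin n → Fin n → ℤ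

sgn : ∀ {n} → Fin n → ℤ
sgn j = sign (toℕ j)

sign-suc : ∀ k → sign (suc k) ≡ - sign k
sign-suc zero          = refl
sign-suc (suc zero)    = refl
sign-suc (suc (suc k)) = sign-suc k

minor : ∀ {n} → Matrix (suc n) → Fin (suc n) → Matrix n
minor M j r c = M (suc r) (punchIn j c)

det-expand : ∀ {n} (M : Matrix (suc n)) → det (suc n) M ≡ ∑[ j < suc n ] (sgn j * M zero j * det n (minor M j))
det-expand {n} M = sumFin≡sum (suc n) (λ j → sgn j * M zero j * det n (minor M j))

det-cong : ∀ n {M N : Matrix n} → (∀ i j → M i j ≡ N i j) → det n M ≡ det n N
det-cong zero    M≡N = refl
det-cong (suc n) {M} {N} M≡N = begin
  det (suc n) M                                              ≡⟨ det-expand M ⟩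
  ∑[ j < suc n ] (sgn j * M zero j * det n (minor M j))      ≡⟨ sum-cong-≗ (λ j → cong₂ (λ m d → sgn j * m * d)
                                                                   (M≡N zero j) (det-cong n (λ r c → M≡N (suc r) (punchIn j c)))) ⟩
  ∑[ j < suc n ] (sgn j * N zero j * det n (minor N j))      ≡⟨ det-expand N ⟨
  det (suc n) N                                              ∎
  where open ≡-Reasoning

det-linearRow : ∀ n (i : Fin n) (a b : ℤ) {M U V : Matrix n} →
  (∀ y → M i y ≡ a * U i y + b * V i y) →
  (∀ x y → x ≢ i → U x y ≡ M x y) → (∀ x y → x ≢ i → V x y ≡ M x y) →
  det n M ≡ a * det n U + b * det n V
det-linearRow (suc n) i a b {M} {U} {V} rowᵢ U≡M V≡M = begin
  det (suc n) M                                                ≡⟨ det-expand M ⟩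
  ∑[ j < suc n ] (sgn j * M zero j * det n (minor M j))        ≡⟨ sum-linear a b (term i rowᵢ U≡M V≡M) ⟩
  a * ∑[ j < suc n ] (sgn j * U zero j * det n (minor U j))
    + b * ∑[ j < suc n ] (sgn j * V zero j * det n (minor V j)) ≡⟨ cong₂ (λ u v → a * u + b * v) (det-expand U) (det-expand V) ⟨
  a * det (suc n) U + b * det (suc n) V                        ∎
  where
  open ≡-Reasoning
  term : ∀ i → (∀ y → M i y ≡ a * U i y + b * V i y) →
    (∀ x y → x ≢ i → U x y ≡ M x y) → (∀ x y → x ≢ i → V x y ≡ M x y) → ∀ j →
    sgn j * M zero j * det n (minor M j) ≡ a * (sgn j * U zero j * det n (minor U j)) + b * (sgn j * V zero j * det n (minor V j))
  term zero rowᵢ U≡M V≡M j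
    rewrite rowᵢ j
          | det-cong n {minor U j} (λ r c → U≡M (suc r) (punchIn j c) λ ())
          | det-cong n {minor V j} (λ r c → V≡M (suc r) (punchIn j c) λ ()) =
    distrib a b (sgn j) (U zero j) (V zero j) (det n (minor M j))
    where
    distrib : ∀ a b s u v d → s * (a * u + b * v) * d ≡ a * (s * u * d) + b * (s * v * d)
    distrib = solve-∀
  term (suc i) rowᵢ U≡M V≡M j
    rewrite U≡M zero j (λ ())
          | V≡M zero j (λ ())
          | det-linearRow n i a b {minor M j} {minor U j} {minor V j} (λ y → rowᵢ (punchIn j y))
              (λ x y x≢i → U≡M (suc x) (punchIn j y) (x≢i ∘ suc-injective))
              (λ x y x≢i → V≡M (suc x) (punchIn j y) (x≢i ∘ suc-injective)) =
    distrib a b (sgn j * M zero j) (det n (minor U j)) (det n (minor V j))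
    where
    distrib : ∀ a b s u v → s * (a * u + b * v) ≡ a * (s * u) + b * (s * v)
    distrib = solve-∀

det-zeroRow : ∀ n (i : Fin n) (M : Matrix n) → (∀ y → M i y ≡ 0ℤ) → det n M ≡ 0ℤ
det-zeroRow n i M rowᵢ≡0 = det-linearRow n i 0ℤ 0ℤ {M} {M} {M} rowᵢ≡0 (λ _ _ _ → refl) (λ _ _ _ → refl)

det-unitRow : ∀ n (M : Matrix (suc n)) (k : Fin (suc n)) → (∀ y → M zero y ≡ δ k y) →
  det (suc n) M ≡ sgn k * det n (minor M k)
det-unitRow n M k row₀≡δ = begin
  det (suc n) M                                          ≡⟨ det-expand M ⟩
  ∑[ j < suc n ] (sgn j * M zero j * det n (minor M j))  ≡⟨ sum-single _ k off-k ⟩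
  sgn k * M zero k * det n (minor M k)                   ≡⟨ cong (λ m → sgn k * m * det n (minor M k)) (trans (row₀≡δ k) (δ-refl k)) ⟩
  sgn k * 1ℤ * det n (minor M k)                         ≡⟨ cong (_* det n (minor M k)) (ℤP.*-identityʳ (sgn k)) ⟩
  sgn k * det n (minor M k)                              ∎
  where
  open ≡-Reasoning
  off-k : ∀ j → j ≢ k → sgn j * M zero j * det n (minor M j) ≡ 0ℤ
  off-k j j≢k rewrite row₀≡δ j | δ-≢ (j≢k ∘ sym) | ℤP.*-zeroʳ (sgn j) = ℤP.*-zeroˡ (det n (minor M j))

sgn-suc : ∀ {n} (j : Fin n) → sgn (suc j) ≡ - sgn j
sgn-suc j = sign-suc (toℕ j)

punchIn-exchange : ∀ {n} (a : Fin (suc (suc n))) (b : Fin (suc n)) →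
  Σ (Fin (suc n)) λ a′ → punchIn (punchIn a b) a′ ≡ a
    × (∀ c → punchIn a (punchIn b c) ≡ punchIn (punchIn a b) (punchIn a′ c))
    × sgn a * sgn b ≡ - (sgn (punchIn a b) * sgn a′)
punchIn-exchange zero b = zero , refl , (λ c → refl) , signs
  where
  signs : 1ℤ * sgn b ≡ - (sgn (suc b) * 1ℤ)
  signs rewrite sgn-suc b = alg (sgn b)
    where
    alg : ∀ s → 1ℤ * s ≡ - (- s * 1ℤ)
    alg = solve-∀
punchIn-exchange (suc a) zero = a , refl , (λ c → refl) , signs
  where
  signs : sgn (suc a) * 1ℤ ≡ - (1ℤ * sgn a)
  signs rewrite sgn-suc a = alg (sgn a)
    where
    alg : ∀ s → - s * 1ℤ ≡ - (1ℤ * s)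
    alg = solve-∀
punchIn-exchange {suc n} (suc a) (suc b) with punchIn-exchange a b
... | a′ , a′-back , commute , signs = suc a′ , cong suc a′-back , commute′ , signs′
  where
  commute′ : ∀ c → punchIn (suc a) (punchIn (suc b) c) ≡ punchIn (suc (punchIn a b)) (punchIn (suc a′) c)
  commute′ zero    = refl
  commute′ (suc c) = cong suc (commute c)
  signs′ : sgn (suc a) * sgn (suc b) ≡ - (sgn (suc (punchIn a b)) * sgn (suc a′))
  signs′ rewrite sgn-suc a | sgn-suc b | sgn-suc (punchIn a b) | sgn-suc a′ =
    trans (neg*neg (sgn a) (sgn b)) (trans signs (cong -_ (sym (neg*neg (sgn (punchIn a b)) (sgn a′)))))
    where
    neg*neg : ∀ x y → - x * - y ≡ x * y
    neg*neg = solve-∀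

setRows₀₁ : ∀ {n} (u v : Fin (suc (suc n)) → ℤ) → Matrix (suc (suc n)) → Matrix (suc (suc n))
setRows₀₁ u v M zero          = u
setRows₀₁ u v M (suc zero)    = v
setRows₀₁ u v M (suc (suc r)) = M (suc (suc r))

module DoubleExpansion {n : ℕ} (M : Matrix (suc (suc n))) where

  -- C a b is the coefficient of M 0 a * M 1 b when det M is expanded along its first two rows.
  C : Fin (suc (suc n)) → Fin (suc (suc n)) → ℤ
  C a b = sgn a * det (suc n) (minor (setRows₀₁ (M zero) (δ b) M) a)

  private
    M₁ : Fin (suc (suc n)) → ℤ
    M₁ = M (suc zero)
    R : Fin (suc (suc n)) → Fin (suc n) → ℤ
    R a c = det n (minor (minor M a) c)

  expand-row₁ : ∀ a → ∑[ b < suc (suc n) ] (M₁ b * C a b) ≡ sgn a * det (suc n) (minor M a)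
  expand-row₁ a = begin
    ∑[ b < suc (suc n) ] (M₁ b * C a b)
      ≡⟨ sum-scale (sgn a) (λ b → trans (cong (λ d → M₁ b * (sgn a * d)) (det-expand (minor (E b) a)))
                                        (swap₁ (M₁ b) (sgn a) (row₀-expansion b))) ⟩
    sgn a * ∑[ b < suc (suc n) ] (M₁ b * row₀-expansion b)
      ≡⟨ cong (sgn a *_) (sum-cong-≗ λ b → sym (sum-scale (M₁ b) (λ c → swap₂ (sgn c) (δ b (punchIn a c)) (R a c) (M₁ b)))) ⟩
    sgn a * ∑[ b < suc (suc n) ] ∑[ c < suc n ] term b c
      ≡⟨ cong (sgn a *_) (∑-comm term) ⟩
    sgn a * ∑[ c < suc n ] ∑[ b < suc (suc n) ] term b c
      ≡⟨ cong (sgn a *_) (sum-cong-≗ λ c → trans (sum-scale (sgn c * R a c) {G = λ b → M₁ b * δ b (punchIn a c)} (λ b → refl))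
                                                  (cong (sgn c * R a c *_) (sum-*δ M₁ (punchIn a c)))) ⟩
    sgn a * ∑[ c < suc n ] (sgn c * R a c * M₁ (punchIn a c))
      ≡⟨ cong (sgn a *_) (trans (sum-cong-≗ λ c → swap₃ (sgn c) (R a c) (M₁ (punchIn a c))) (sym (det-expand (minor M a)))) ⟩
    sgn a * det (suc n) (minor M a)
      ∎
    where
    open ≡-Reasoning
    E : Fin (suc (suc n)) → Matrix (suc (suc n))
    E b = setRows₀₁ (M zero) (δ b) M
    row₀-expansion : Fin (suc (suc n)) → ℤ
    row₀-expansion b = ∑[ c < suc n ] (sgn c * δ b (punchIn a c) * R a c)
    term : Fin (suc (suc n)) → Fin (suc n) → ℤ
    term b c = sgn c * R a c * (M₁ b * δ b (punchIn a c))
    swap₁ : ∀ x s d → x * (s * d) ≡ s * (x * d)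
    swap₁ = solve-∀
    swap₂ : ∀ s e r x → s * r * (x * e) ≡ x * (s * e * r)
    swap₂ = solve-∀
    swap₃ : ∀ s r x → s * r * x ≡ s * x * r
    swap₃ = solve-∀

  det-expand₂ : det (suc (suc n)) M ≡ ∑[ a < suc (suc n) ] ∑[ b < suc (suc n) ] (M zero a * M₁ b * C a b)
  det-expand₂ = begin
    det (suc (suc n)) M
      ≡⟨ det-expand M ⟩
    ∑[ a < suc (suc n) ] (sgn a * M zero a * det (suc n) (minor M a))
      ≡⟨ sum-cong-≗ (λ a → trans (swap (sgn a) (M zero a) (det (suc n) (minor M a))) (cong (M zero a *_) (sym (expand-row₁ a)))) ⟩
    ∑[ a < suc (suc n) ] (M zero a * ∑[ b < suc (suc n) ] (M₁ b * C a b))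
      ≡⟨ sum-cong-≗ (λ a → sym (sum-scale (M zero a) (λ b → ℤP.*-assoc (M zero a) (M₁ b) (C a b)))) ⟩
    ∑[ a < suc (suc n) ] ∑[ b < suc (suc n) ] (M zero a * M₁ b * C a b)
      ∎
    where
    open ≡-Reasoning
    swap : ∀ s m d → s * m * d ≡ m * (s * d)
    swap = solve-∀

  C-diag : ∀ a → C a a ≡ 0ℤ
  C-diag a =
    trans (cong (sgn a *_) (det-zeroRow (suc n) zero (minor (setRows₀₁ (M zero) (δ a) M) a) (λ c → δ-≢ (punchInᵢ≢i a c ∘ sym))))
          (ℤP.*-zeroʳ (sgn a))

  C-antisym : ∀ a b → C a (punchIn a b) ≡ - C (punchIn a b) a
  C-antisym a b with punchIn-exchange a b
  ... | a′ , a′-back , commute , signs = begin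
    sgn a * det (suc n) (minor (setRows₀₁ (M zero) (δ (punchIn a b)) M) a)
      ≡⟨ cong (sgn a *_) (det-unitRow n (minor (setRows₀₁ (M zero) (δ (punchIn a b)) M) a) b (δ-punchIn a b)) ⟩
    sgn a * (sgn b * R a b)
      ≡⟨ cong (λ r → sgn a * (sgn b * r)) (det-cong n (λ r c → cong (M (suc (suc r))) (commute c))) ⟩
    sgn a * (sgn b * R (punchIn a b) a′)
      ≡⟨ exchange (sgn a) (sgn b) (sgn (punchIn a b)) (sgn a′) (R (punchIn a b) a′) signs ⟩
    - (sgn (punchIn a b) * (sgn a′ * R (punchIn a b) a′))
      ≡⟨ cong (λ d → - (sgn (punchIn a b) * d)) (det-unitRow n (minor (setRows₀₁ (M zero) (δ a) M) (punchIn a b)) a′ unit) ⟨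
    - (sgn (punchIn a b) * det (suc n) (minor (setRows₀₁ (M zero) (δ a) M) (punchIn a b)))
      ∎
    where
    open ≡-Reasoning
    unit : ∀ y → δ a (punchIn (punchIn a b) y) ≡ δ a′ y
    unit y = trans (cong (λ z → δ z (punchIn (punchIn a b) y)) (sym a′-back)) (δ-punchIn (punchIn a b) a′ y)
    exchange : ∀ w x y z d → w * x ≡ - (y * z) → w * (x * d) ≡ - (y * (z * d))
    exchange w x y z d wx≡ = trans (sym (ℤP.*-assoc w x d)) (trans (cong (_* d) wx≡) (reassoc y z d))
      where
      reassoc : ∀ y z d → - (y * z) * d ≡ - (y * (z * d))
      reassoc = solve-∀

det-equalRows₀₁ : ∀ n (M : Matrix (suc (suc n))) → (∀ y → M zero y ≡ M (suc zero) y) → det (suc (suc n)) M ≡ 0ℤ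
det-equalRows₀₁ n M row₀≡row₁ = trans det-expand₂ (sum-antisym (λ a b → M zero a * M (suc zero) b * C a b) antisym)
  where
  open DoubleExpansion M
  antisym : ∀ a b → M zero a * M (suc zero) b * C a b ≡ - (M zero b * M (suc zero) a * C b a)
  antisym a b with a ≟ᶠ b
  ... | yes refl rewrite C-diag a = trans (ℤP.*-zeroʳ (M zero a * M (suc zero) a)) (cong -_ (sym (ℤP.*-zeroʳ (M zero a * M (suc zero) a))))
  ... | no a≢b rewrite row₀≡row₁ a | row₀≡row₁ b =
    trans (cong (M (suc zero) a * M (suc zero) b *_) C-anti) (alg (M (suc zero) a) (M (suc zero) b) (C b a))
    where
    C-anti : C a b ≡ - C b a
    C-anti = subst (λ z → C a z ≡ - C z a) (punchIn-punchOut a≢b) (C-antisym a (punchOut a≢b))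
    alg : ∀ x y d → x * y * - d ≡ - (y * x * d)
    alg = solve-∀

det-addRow : ∀ n (i : Fin n) {M U V : Matrix n} → (∀ y → M i y ≡ U i y + V i y) →
  (∀ x y → x ≢ i → U x y ≡ M x y) → (∀ x y → x ≢ i → V x y ≡ M x y) →
  det n M ≡ det n U + det n V
det-addRow n i {M} {U} {V} rowᵢ U≡M V≡M =
  trans (det-linearRow n i 1ℤ 1ℤ (λ y → trans (rowᵢ y) (sym (cong₂ _+_ (ℤP.*-identityˡ (U i y)) (ℤP.*-identityˡ (V i y))))) U≡M V≡M)
        (cong₂ _+_ (ℤP.*-identityˡ (det n U)) (ℤP.*-identityˡ (det n V)))

bilinear-alternating⇒antisymmetric : ∀ {A : Set} (D : (A → ℤ) → (A → ℤ) → ℤ) →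
  (∀ u v w → D (λ i → u i + v i) w ≡ D u w + D v w) →
  (∀ u v w → D w (λ i → u i + v i) ≡ D w u + D w v) →
  (∀ u → D u u ≡ 0ℤ) → ∀ u v → D u v + D v u ≡ 0ℤ
bilinear-alternating⇒antisymmetric {A} D additiveˡ additiveʳ alternating u v = begin
  D u v + D v u                              ≡⟨ alg (D u u) (D u v) (D v u) (D v v) (alternating u) (alternating v) ⟩
  (D u u + D u v) + (D v u + D v v)          ≡⟨ cong₂ _+_ (additiveʳ u v u) (additiveʳ u v v) ⟨
  D u s + D v s                              ≡⟨ additiveˡ u v s ⟨
  D s s                                      ≡⟨ alternating s ⟩
  0ℤ                                         ∎
  where
  open ≡-Reasoning
  s : A → ℤ
  s i = u i + v i
  alg : ∀ a b c d → a ≡ 0ℤ → d ≡ 0ℤ → b + c ≡ (a + b) + (c + d)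
  alg a b c d refl refl = cong₂ _+_ (sym (ℤP.+-identityˡ b)) (sym (ℤP.+-identityʳ c))

det-swapRows₀₁ : ∀ n (M : Matrix (suc (suc n))) →
  det (suc (suc n)) M + det (suc (suc n)) (setRows₀₁ (M (suc zero)) (M zero) M) ≡ 0ℤ
det-swapRows₀₁ n M =
  trans (cong (_+ D y x) (det-cong (suc (suc n)) M≡)) (bilinear-alternating⇒antisymmetric D additiveˡ additiveʳ alternating x y)
  where
  x : Fin (suc (suc n)) → ℤ
  x = M zero
  y : Fin (suc (suc n)) → ℤ
  y = M (suc zero)
  D : (Fin (suc (suc n)) → ℤ) → (Fin (suc (suc n)) → ℤ) → ℤ
  D u v = det (suc (suc n)) (setRows₀₁ u v M)
  M≡ : ∀ i j → M i j ≡ setRows₀₁ x y M i j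
  M≡ zero          j = refl
  M≡ (suc zero)    j = refl
  M≡ (suc (suc i)) j = refl
  additiveˡ : ∀ u v w → D (λ i → u i + v i) w ≡ D u w + D v w
  additiveˡ u v w = det-addRow (suc (suc n)) zero {setRows₀₁ (λ i → u i + v i) w M} {setRows₀₁ u w M} {setRows₀₁ v w M}
    (λ _ → refl) agree agree
    where
    agree : ∀ {u′} i j → i ≢ zero → setRows₀₁ u′ w M i j ≡ setRows₀₁ (λ i → u i + v i) w M i j
    agree zero          j i≢0 = ⊥-elim (i≢0 refl)
    agree (suc zero)    j i≢0 = refl
    agree (suc (suc i)) j i≢0 = refl
  additiveʳ : ∀ u v w → D w (λ i → u i + v i) ≡ D w u + D w v
  additiveʳ u v w = det-addRow (suc (suc n)) (suc zero) {setRows₀₁ w (λ i → u i + v i) M} {setRows₀₁ w u M} {setRows₀₁ w v M}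
    (λ _ → refl) agree agree
    where
    agree : ∀ {v′} i j → i ≢ suc zero → setRows₀₁ w v′ M i j ≡ setRows₀₁ w (λ i → u i + v i) M i j
    agree zero          j i≢1 = refl
    agree (suc zero)    j i≢1 = ⊥-elim (i≢1 refl)
    agree (suc (suc i)) j i≢1 = refl
  alternating : ∀ u → D u u ≡ 0ℤ
  alternating u = det-equalRows₀₁ n (setRows₀₁ u u M) (λ _ → refl)

AlternatingRows : ℕ → Set
AlternatingRows n = ∀ (M : Matrix n) (i j : Fin n) → i ≢ j → (∀ y → M i y ≡ M j y) → det n M ≡ 0ℤ

private
  det-equalLowerRows : ∀ n → AlternatingRows n → ∀ (M : Matrix (suc n)) (i j : Fin n) → i ≢ j →
    (∀ y → M (suc i) y ≡ M (suc j) y) → det (suc n) M ≡ 0ℤ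
  det-equalLowerRows n alternating M i j i≢j rows≡ =
    trans (det-expand M) (sum-zero (λ k → sgn k * M zero k * det n (minor M k)) λ k →
      trans (cong (sgn k * M zero k *_) (alternating (minor M k) i j i≢j (rows≡ ∘ punchIn k))) (ℤP.*-zeroʳ (sgn k * M zero k)))

  det-equalRow₀ : ∀ n → AlternatingRows (suc n) → ∀ (M : Matrix (suc (suc n))) (j : Fin (suc n)) →
    (∀ y → M zero y ≡ M (suc j) y) → det (suc (suc n)) M ≡ 0ℤ
  det-equalRow₀ n alternating M zero    rows≡ = det-equalRows₀₁ n M rows≡
  det-equalRow₀ n alternating M (suc j) rows≡ = begin
    det (suc (suc n)) M              ≡⟨ ℤP.+-identityʳ _ ⟨
    det (suc (suc n)) M + 0ℤ         ≡⟨ cong (λ d → det (suc (suc n)) M + d) swapped≡0 ⟨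
    det (suc (suc n)) M + det (suc (suc n)) swapped ≡⟨ det-swapRows₀₁ n M ⟩
    0ℤ                               ∎
    where
    open ≡-Reasoning
    swapped : Matrix (suc (suc n))
    swapped = setRows₀₁ (M (suc zero)) (M zero) M
    swapped≡0 : det (suc (suc n)) swapped ≡ 0ℤ
    swapped≡0 = det-equalLowerRows (suc n) alternating swapped zero (suc j) (λ ()) rows≡

det-equalRows : ∀ n → AlternatingRows n
det-equalRows (suc n) M zero    zero    0≢0 rows≡ = ⊥-elim (0≢0 refl)
det-equalRows (suc n) M (suc i) (suc j) i≢j rows≡ = det-equalLowerRows n (det-equalRows n) M i j (i≢j ∘ cong suc) rows≡
det-equalRows (suc (suc n)) M zero    (suc j) _ rows≡ = det-equalRow₀ n (det-equalRows (suc n)) M j rows≡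
det-equalRows (suc (suc n)) M (suc i) zero    _ rows≡ = det-equalRow₀ n (det-equalRows (suc n)) M i (sym ∘ rows≡)

det-rowOp : ∀ n {M N : Matrix n} (i k : Fin n) (c : ℤ) → i ≢ k →
  (∀ y → N i y ≡ M i y + c * M k y) → (∀ x y → x ≢ i → N x y ≡ M x y) → det n N ≡ det n M
det-rowOp n {M} {N} i k c i≢k rowᵢ others = begin
  det n N                       ≡⟨ det-linearRow n i 1ℤ c {N} {M} {K} rowᵢ′ (λ x y x≢i → sym (others x y x≢i)) K≡N ⟩
  1ℤ * det n M + c * det n K    ≡⟨ cong (λ d → 1ℤ * det n M + c * d) (det-equalRows n K i k i≢k K-rows) ⟩
  1ℤ * det n M + c * 0ℤ         ≡⟨ alg (det n M) c ⟩
  det n M                       ∎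
  where
  open ≡-Reasoning
  K : Matrix n
  K = updateAt M i (λ _ → M k)
  K-rowᵢ : K i ≡ M k
  K-rowᵢ = updateAt-updates i M
  K-rows : ∀ y → K i y ≡ K k y
  K-rows y = trans (cong (λ r → r y) K-rowᵢ) (sym (cong (λ r → r y) (updateAt-minimal k i M (i≢k ∘ sym))))
  rowᵢ′ : ∀ y → N i y ≡ 1ℤ * M i y + c * K i y
  rowᵢ′ y = trans (rowᵢ y) (cong₂ _+_ (sym (ℤP.*-identityˡ (M i y))) (cong (c *_) (sym (cong (λ r → r y) K-rowᵢ))))
  K≡N : ∀ x y → x ≢ i → K x y ≡ N x y
  K≡N x y x≢i = trans (cong (λ r → r y) (updateAt-minimal x i M x≢i)) (sym (others x y x≢i))
  alg : ∀ d c → 1ℤ * d + c * 0ℤ ≡ d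
  alg = solve-∀

det-linearCol : ∀ n (c : Fin n) (a b : ℤ) {M U V : Matrix n} →
  (∀ x → M x c ≡ a * U x c + b * V x c) →
  (∀ x y → y ≢ c → U x y ≡ M x y) → (∀ x y → y ≢ c → V x y ≡ M x y) →
  det n M ≡ a * det n U + b * det n V
det-linearCol (suc n) c a b {M} {U} {V} colc U≡M V≡M = begin
  det (suc n) M                                                ≡⟨ det-expand M ⟩
  ∑[ j < suc n ] (sgn j * M zero j * det n (minor M j))        ≡⟨ sum-linear a b term ⟩
  a * ∑[ j < suc n ] (sgn j * U zero j * det n (minor U j))
    + b * ∑[ j < suc n ] (sgn j * V zero j * det n (minor V j)) ≡⟨ cong₂ (λ u v → a * u + b * v) (det-expand U) (det-expand V) ⟨
  a * det (suc n) U + b * det (suc n) V                        ∎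
  where
  open ≡-Reasoning
  term : ∀ j → sgn j * M zero j * det n (minor M j) ≡ a * (sgn j * U zero j * det n (minor U j)) + b * (sgn j * V zero j * det n (minor V j))
  term j with j ≟ᶠ c
  ... | yes refl
    rewrite colc zero
          | det-cong n {minor U j} (λ r y → U≡M (suc r) (punchIn j y) (punchInᵢ≢i j y))
          | det-cong n {minor V j} (λ r y → V≡M (suc r) (punchIn j y) (punchInᵢ≢i j y)) =
    distrib a b (sgn j) (U zero j) (V zero j) (det n (minor M j))
    where
    distrib : ∀ a b s u v d → s * (a * u + b * v) * d ≡ a * (s * u * d) + b * (s * v * d)
    distrib = solve-∀
  ... | no j≢c = begin
    sgn j * M zero j * det n (minor M j)
      ≡⟨ cong (sgn j * M zero j *_) minor-linear ⟩
    sgn j * M zero j * (a * det n (minor U j) + b * det n (minor V j))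
      ≡⟨ distrib a b (sgn j * M zero j) (det n (minor U j)) (det n (minor V j)) ⟩
    a * (sgn j * M zero j * det n (minor U j)) + b * (sgn j * M zero j * det n (minor V j))
      ≡⟨ cong₂ (λ u v → a * (sgn j * u * det n (minor U j)) + b * (sgn j * v * det n (minor V j))) (U≡M zero j j≢c) (V≡M zero j j≢c) ⟨
    a * (sgn j * U zero j * det n (minor U j)) + b * (sgn j * V zero j * det n (minor V j))
      ∎
    where
    c′ : Fin n
    c′ = punchOut j≢c
    punchIn-c′ : punchIn j c′ ≡ c
    punchIn-c′ = punchIn-punchOut j≢c
    punchIn≡c⇒≡c′ : ∀ y → punchIn j y ≡ c → y ≡ c′
    punchIn≡c⇒≡c′ y eq = punchIn-injective j y c′ (trans eq (sym punchIn-c′))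
    minor-col : ∀ x → minor M j x c′ ≡ a * minor U j x c′ + b * minor V j x c′
    minor-col x rewrite punchIn-c′ = colc (suc x)
    minor-linear : det n (minor M j) ≡ a * det n (minor U j) + b * det n (minor V j)
    minor-linear = det-linearCol n c′ a b {minor M j} {minor U j} {minor V j} minor-col
      (λ x y y≢c′ → U≡M (suc x) (punchIn j y) (y≢c′ ∘ punchIn≡c⇒≡c′ y))
      (λ x y y≢c′ → V≡M (suc x) (punchIn j y) (y≢c′ ∘ punchIn≡c⇒≡c′ y))
    distrib : ∀ a b s u v → s * (a * u + b * v) ≡ a * (s * u) + b * (s * v)
    distrib = solve-∀

punchIn-adjacent : ∀ {n} (k c : Fin (suc n)) →
  punchIn (inject₁ k) c ≡ punchIn (suc k) c ⊎ (punchIn (inject₁ k) c ≡ suc k × punchIn (suc k) c ≡ inject₁ k)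
punchIn-adjacent zero          zero    = inj₂ (refl , refl)
punchIn-adjacent zero          (suc c) = inj₁ refl
punchIn-adjacent {suc n} (suc k) zero    = inj₁ refl
punchIn-adjacent {suc n} (suc k) (suc c) with punchIn-adjacent k c
... | inj₁ eq          = inj₁ (cong suc eq)
... | inj₂ (eq₁ , eq₂) = inj₂ (cong suc eq₁ , cong suc eq₂)

punchIn-adjacentPair : ∀ {n} (j : Fin (suc (suc (suc n)))) (k : Fin (suc (suc n))) → j ≢ inject₁ k → j ≢ suc k →
  Σ (Fin (suc n)) λ k′ → punchIn j (inject₁ k′) ≡ inject₁ k × punchIn j (suc k′) ≡ suc k
punchIn-adjacentPair zero                zero          j≢k _    = ⊥-elim (j≢k refl)
punchIn-adjacentPair zero                (suc k)       _   _    = k , refl , refl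
punchIn-adjacentPair (suc zero)          zero          _   j≢k+1 = ⊥-elim (j≢k+1 refl)
punchIn-adjacentPair (suc (suc j))       zero          _   _    = zero , refl , refl
punchIn-adjacentPair {zero} (suc zero)       (suc zero) j≢k _   = ⊥-elim (j≢k refl)
punchIn-adjacentPair {zero} (suc (suc zero)) (suc zero) _  j≢k+1 = ⊥-elim (j≢k+1 refl)
punchIn-adjacentPair {suc n} (suc j) (suc k) j≢k j≢k+1
  with punchIn-adjacentPair j k (j≢k ∘ cong suc) (j≢k+1 ∘ cong suc)
... | k′ , eq₁ , eq₂ = suc k′ , cong suc eq₁ , cong suc eq₂

sum-adjacentPair : ∀ {n} (f : Fin (suc (suc n)) → ℤ) (k : Fin (suc n)) →
  (∀ j → j ≢ inject₁ k → j ≢ suc k → f j ≡ 0ℤ) → f (inject₁ k) + f (suc k) ≡ 0ℤ → sum f ≡ 0ℤ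
sum-adjacentPair {n} f zero others pair
  rewrite sum-zero (λ j → f (suc (suc j))) (λ j → others (suc (suc j)) (λ ()) (λ ())) =
  trans (cong (λ s → f zero + s) (ℤP.+-identityʳ (f (suc zero)))) pair
sum-adjacentPair {suc n} f (suc k) others pair rewrite others zero (λ ()) (λ ()) =
  trans (ℤP.+-identityˡ _)
        (sum-adjacentPair (f ∘ suc) k (λ j j≢k j≢k+1 → others (suc j) (j≢k ∘ suc-injective) (j≢k+1 ∘ suc-injective)) pair)

det-equalAdjacentCols : ∀ n (M : Matrix (suc (suc n))) (k : Fin (suc n)) →
  (∀ x → M x (inject₁ k) ≡ M x (suc k)) → det (suc (suc n)) M ≡ 0ℤ
det-equalAdjacentCols n M k cols≡ =
  trans (det-expand M) (sum-adjacentPair (λ j → sgn j * M zero j * det (suc n) (minor M j)) k off-pair pair)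
  where
  off-pair : ∀ j → j ≢ inject₁ k → j ≢ suc k → sgn j * M zero j * det (suc n) (minor M j) ≡ 0ℤ
  off-pair j j≢k j≢k+1 = trans (cong (sgn j * M zero j *_) (minor≡0 n M j k j≢k j≢k+1 cols≡)) (ℤP.*-zeroʳ (sgn j * M zero j))
    where
    minor≡0 : ∀ n (M : Matrix (suc (suc n))) j k → j ≢ inject₁ k → j ≢ suc k →
      (∀ x → M x (inject₁ k) ≡ M x (suc k)) → det (suc n) (minor M j) ≡ 0ℤ
    minor≡0 zero M zero       zero j≢k _     _ = ⊥-elim (j≢k refl)
    minor≡0 zero M (suc zero) zero _   j≢k+1 _ = ⊥-elim (j≢k+1 refl)
    minor≡0 (suc n) M j k j≢k j≢k+1 cols≡ with punchIn-adjacentPair j k j≢k j≢k+1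
    ... | k′ , eq₁ , eq₂ = det-equalAdjacentCols n (minor M j) k′
      (λ x → subst₂ (λ u v → M (suc x) u ≡ M (suc x) v) (sym eq₁) (sym eq₂) (cols≡ (suc x)))
  minors≡ : det (suc n) (minor M (inject₁ k)) ≡ det (suc n) (minor M (suc k))
  minors≡ = det-cong (suc n) λ r c → entry r c (punchIn-adjacent k c)
    where
    entry : ∀ r c → _ → M (suc r) (punchIn (inject₁ k) c) ≡ M (suc r) (punchIn (suc k) c)
    entry r c (inj₁ eq)          = cong (M (suc r)) eq
    entry r c (inj₂ (eq₁ , eq₂)) rewrite eq₁ | eq₂ = sym (cols≡ (suc r))
  pair : sgn (inject₁ k) * M zero (inject₁ k) * det (suc n) (minor M (inject₁ k))
       + sgn (suc k) * M zero (suc k) * det (suc n) (minor M (suc k)) ≡ 0ℤ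
  pair rewrite minors≡ | cols≡ zero | toℕ-inject₁ k | sgn-suc k = cancel (sgn k) (M zero (suc k)) (det (suc n) (minor M (suc k)))
    where
    cancel : ∀ s m d → s * m * d + - s * m * d ≡ 0ℤ
    cancel = solve-∀

setCol : ∀ {n} → Matrix n → Fin n → (Fin n → ℤ) → Matrix n
setCol M j v x = updateAt (M x) j (λ _ → v x)

setCol-here : ∀ {n} (M : Matrix n) j v x → setCol M j v x j ≡ v x
setCol-here M j v x = updateAt-updates j (M x)

setCol-there : ∀ {n} (M : Matrix n) j v x y → y ≢ j → setCol M j v x y ≡ M x y
setCol-there M j v x y y≢j = updateAt-minimal y j (M x) y≢j

det-addCol : ∀ n (c : Fin n) {M U V : Matrix n} → (∀ x → M x c ≡ U x c + V x c) →
  (∀ x y → y ≢ c → U x y ≡ M x y) → (∀ x y → y ≢ c → V x y ≡ M x y) →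
  det n M ≡ det n U + det n V
det-addCol n c {M} {U} {V} colc U≡M V≡M =
  trans (det-linearCol n c 1ℤ 1ℤ (λ x → trans (colc x) (sym (cong₂ _+_ (ℤP.*-identityˡ (U x c)) (ℤP.*-identityˡ (V x c))))) U≡M V≡M)
        (cong₂ _+_ (ℤP.*-identityˡ (det n U)) (ℤP.*-identityˡ (det n V)))

inject₁≢suc : ∀ {n} (k : Fin n) → inject₁ k ≢ suc k
inject₁≢suc k eq = ℕP.1+n≢n (sym (trans (sym (toℕ-inject₁ k)) (cong toℕ eq)))

swapAdjacentCols : ∀ {n} → Matrix (suc (suc n)) → Fin (suc n) → Matrix (suc (suc n))
swapAdjacentCols M k = setCol (setCol M (suc k) (λ x → M x (inject₁ k))) (inject₁ k) (λ x → M x (suc k))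

det-swapAdjacentCols : ∀ n (M : Matrix (suc (suc n))) (k : Fin (suc n)) →
  det (suc (suc n)) M + det (suc (suc n)) (swapAdjacentCols M k) ≡ 0ℤ
det-swapAdjacentCols n M k =
  trans (cong (_+ D v u) (det-cong (suc (suc n)) M≡)) (bilinear-alternating⇒antisymmetric D additiveˡ additiveʳ alternating u v)
  where
  u : Fin (suc (suc n)) → ℤ
  u x = M x (inject₁ k)
  v : Fin (suc (suc n)) → ℤ
  v x = M x (suc k)
  S : (Fin (suc (suc n)) → ℤ) → (Fin (suc (suc n)) → ℤ) → Matrix (suc (suc n))
  S u v = setCol (setCol M (suc k) v) (inject₁ k) u
  D : (Fin (suc (suc n)) → ℤ) → (Fin (suc (suc n)) → ℤ) → ℤ
  D u v = det (suc (suc n)) (S u v)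
  S-left : ∀ u v x → S u v x (inject₁ k) ≡ u x
  S-left u v x = setCol-here (setCol M (suc k) v) (inject₁ k) u x
  S-right : ∀ u v x → S u v x (suc k) ≡ v x
  S-right u v x = trans (setCol-there (setCol M (suc k) v) (inject₁ k) u x (suc k) (inject₁≢suc k ∘ sym)) (setCol-here M (suc k) v x)
  S-else : ∀ u v x y → y ≢ inject₁ k → y ≢ suc k → S u v x y ≡ M x y
  S-else u v x y y≢k y≢k+1 = trans (setCol-there (setCol M (suc k) v) (inject₁ k) u x y y≢k) (setCol-there M (suc k) v x y y≢k+1)
  M≡ : ∀ x y → M x y ≡ S u v x y
  M≡ x y with y ≟ᶠ inject₁ k | y ≟ᶠ suc k
  ... | yes refl | _        = sym (S-left u v x)
  ... | no _     | yes refl = sym (S-right u v x)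
  ... | no y≢k   | no y≢k+1 = sym (S-else u v x y y≢k y≢k+1)
  additiveˡ : ∀ u v w → D (λ i → u i + v i) w ≡ D u w + D v w
  additiveˡ u v w = det-addCol (suc (suc n)) (inject₁ k) {S (λ i → u i + v i) w} {S u w} {S v w}
    (λ x → trans (S-left (λ i → u i + v i) w x) (sym (cong₂ _+_ (S-left u w x) (S-left v w x)))) agree agree
    where
    agree : ∀ {u′} x y → y ≢ inject₁ k → S u′ w x y ≡ S (λ i → u i + v i) w x y
    agree {u′} x y y≢k = trans (setCol-there (setCol M (suc k) w) (inject₁ k) u′ x y y≢k)
      (sym (setCol-there (setCol M (suc k) w) (inject₁ k) (λ i → u i + v i) x y y≢k))
  additiveʳ : ∀ u v w → D w (λ i → u i + v i) ≡ D w u + D w v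
  additiveʳ u v w = det-addCol (suc (suc n)) (suc k) {S w (λ i → u i + v i)} {S w u} {S w v}
    (λ x → trans (S-right w (λ i → u i + v i) x) (sym (cong₂ _+_ (S-right w u x) (S-right w v x)))) agree agree
    where
    agree : ∀ {v′} x y → y ≢ suc k → S w v′ x y ≡ S w (λ i → u i + v i) x y
    agree {v′} x y y≢k+1 with y ≟ᶠ inject₁ k
    ... | yes refl = trans (S-left w v′ x) (sym (S-left w (λ i → u i + v i) x))
    ... | no y≢k   = trans (S-else w v′ x y y≢k y≢k+1) (sym (S-else w (λ i → u i + v i) x y y≢k y≢k+1))
  alternating : ∀ u → D u u ≡ 0ℤ
  alternating u = det-equalAdjacentCols n (S u u) k (λ x → trans (S-left u u x) (sym (S-right u u x)))

-- Swapping the columns k and k + 1 moves the copy of column c₁ at c₂ = k + 1 one step closer to c₁.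
private
  det-equalColsAtGap : ∀ d n (M : Matrix n) (c₁ c₂ : Fin n) → toℕ c₂ ≡ suc (toℕ c₁ ℕ.+ d) →
    (∀ x → M x c₁ ≡ M x c₂) → det n M ≡ 0ℤ
  det-equalColsAtGap d (suc (suc n)) M c₁ (suc k) gap cols≡ with d
  ... | zero = det-equalAdjacentCols n M k (λ x → subst (λ c → M x c ≡ M x (suc k)) c₁≡k (cols≡ x))
    where
    c₁≡k : c₁ ≡ inject₁ k
    c₁≡k = toℕ-injective (trans (sym (ℕP.+-identityʳ (toℕ c₁))) (trans (sym (ℕP.suc-injective gap)) (sym (toℕ-inject₁ k))))
  ... | suc d′ = begin
    det (suc (suc n)) M                                            ≡⟨ ℤP.+-identityʳ _ ⟨
    det (suc (suc n)) M + 0ℤ                                       ≡⟨ cong (λ z → det (suc (suc n)) M + z) swapped≡0 ⟨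
    det (suc (suc n)) M + det (suc (suc n)) swapped                ≡⟨ det-swapAdjacentCols n M k ⟩
    0ℤ                                                             ∎
    where
    open ≡-Reasoning
    u : Fin (suc (suc n)) → ℤ
    u x = M x (inject₁ k)
    v : Fin (suc (suc n)) → ℤ
    v x = M x (suc k)
    M′ : Matrix (suc (suc n))
    M′ = setCol M (suc k) u
    swapped : Matrix (suc (suc n))
    swapped = swapAdjacentCols M k
    k-gap : toℕ k ≡ toℕ c₁ ℕ.+ suc d′
    k-gap = ℕP.suc-injective gap
    c₁≢k : c₁ ≢ inject₁ k
    c₁≢k eq = ℕP.m≢1+m+n (toℕ c₁) (trans (cong toℕ eq) (trans (toℕ-inject₁ k) (trans k-gap (ℕP.+-suc (toℕ c₁) d′))))
    c₁≢k+1 : c₁ ≢ suc k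
    c₁≢k+1 eq = ℕP.m≢1+m+n (toℕ c₁) (trans (cong toℕ eq) gap)
    swapped≡0 : det (suc (suc n)) swapped ≡ 0ℤ
    swapped≡0 = det-equalColsAtGap d′ (suc (suc n)) swapped c₁ (inject₁ k)
      (trans (toℕ-inject₁ k) (trans k-gap (ℕP.+-suc (toℕ c₁) d′)))
      (λ x → trans (setCol-there M′ (inject₁ k) v x c₁ c₁≢k) (trans (setCol-there M (suc k) u x c₁ c₁≢k+1)
               (trans (cols≡ x) (sym (setCol-here M′ (inject₁ k) v x)))))

det-equalCols : ∀ n (M : Matrix n) (c₁ c₂ : Fin n) → c₁ ≢ c₂ → (∀ x → M x c₁ ≡ M x c₂) → det n M ≡ 0ℤ
det-equalCols n M c₁ c₂ c₁≢c₂ cols≡ with ℕP.<-cmp (toℕ c₁) (toℕ c₂)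
... | tri< c₁<c₂ _ _ = let d , gap = ℕP.m≤n⇒∃[o]m+o≡n c₁<c₂ in det-equalColsAtGap d n M c₁ c₂ (sym gap) cols≡
... | tri≈ _ c₁≡c₂ _ = ⊥-elim (c₁≢c₂ (toℕ-injective c₁≡c₂))
... | tri> _ _ c₂<c₁ = let d , gap = ℕP.m≤n⇒∃[o]m+o≡n c₂<c₁ in det-equalColsAtGap d n M c₂ c₁ (sym gap) (sym ∘ cols≡)

det-colOp : ∀ n {M N : Matrix n} (j k : Fin n) (c : ℤ) → j ≢ k →
  (∀ x → N x j ≡ M x j + c * M x k) → (∀ x y → y ≢ j → N x y ≡ M x y) → det n N ≡ det n M
det-colOp n {M} {N} j k c j≢k colj others = begin
  det n N                       ≡⟨ det-linearCol n j 1ℤ c {N} {M} {K} colj′ (λ x y y≢j → sym (others x y y≢j)) K≡N ⟩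
  1ℤ * det n M + c * det n K    ≡⟨ cong (λ d → 1ℤ * det n M + c * d) (det-equalCols n K j k j≢k K-cols) ⟩
  1ℤ * det n M + c * 0ℤ         ≡⟨ alg (det n M) c ⟩
  det n M                       ∎
  where
  open ≡-Reasoning
  K : Matrix n
  K = setCol M j (λ x → M x k)
  K-cols : ∀ x → K x j ≡ K x k
  K-cols x = trans (setCol-here M j (λ x → M x k) x) (sym (setCol-there M j (λ x → M x k) x k (j≢k ∘ sym)))
  colj′ : ∀ x → N x j ≡ 1ℤ * M x j + c * K x j
  colj′ x = trans (colj x) (cong₂ _+_ (sym (ℤP.*-identityˡ (M x j))) (cong (c *_) (sym (setCol-here M j (λ x → M x k) x))))
  K≡N : ∀ x y → y ≢ j → K x y ≡ N x y
  K≡N x y y≢j = trans (setCol-there M j (λ x → M x k) x y y≢j) (sym (others x y y≢j))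
  alg : ∀ d c → 1ℤ * d + c * 0ℤ ≡ d
  alg = solve-∀

punchIn-inject₁ : ∀ {n} (j : Fin (suc n)) (c : Fin n) → punchIn (inject₁ j) (inject₁ c) ≡ inject₁ (punchIn j c)
punchIn-inject₁ zero    c       = refl
punchIn-inject₁ (suc j) zero    = refl
punchIn-inject₁ (suc j) (suc c) = cong suc (punchIn-inject₁ j c)

punchIn-inject₁-fromℕ : ∀ n (j : Fin (suc n)) → punchIn (inject₁ j) (fromℕ n) ≡ fromℕ (suc n)
punchIn-inject₁-fromℕ n       zero    = refl
punchIn-inject₁-fromℕ (suc n) (suc j) = cong suc (punchIn-inject₁-fromℕ n j)

punchIn-fromℕ : ∀ {n} (c : Fin n) → punchIn (fromℕ n) c ≡ inject₁ c
punchIn-fromℕ zero    = refl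
punchIn-fromℕ (suc c) = cong suc (punchIn-fromℕ c)

topLeft : ∀ {k} → Matrix (suc k) → Matrix k
topLeft M x y = M (inject₁ x) (inject₁ y)

det-lastRowDiagonal : ∀ k (M : Matrix (suc k)) → (∀ y → M (fromℕ k) (inject₁ y) ≡ 0ℤ) →
  det (suc k) M ≡ M (fromℕ k) (fromℕ k) * det k (topLeft M)
det-lastRowDiagonal zero M _ = alg (M zero zero)
  where
  alg : ∀ m → 1ℤ * m * 1ℤ + 0ℤ ≡ m * 1ℤ
  alg = solve-∀
det-lastRowDiagonal (suc k) M lastRow≡0 = begin
  det (suc (suc k)) M
    ≡⟨ det-expand M ⟩
  ∑[ j < suc (suc k) ] T j
    ≡⟨ sum-init-last T ⟩
  ∑[ j < suc k ] T (inject₁ j) + T (fromℕ (suc k))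
    ≡⟨ cong₂ _+_ (sum-scale m (λ j → T-inject₁ j)) T-last ⟩
  m * ∑[ j < suc k ] (sgn j * topLeft M zero j * det k (minor (topLeft M) j)) + 0ℤ
    ≡⟨ cong (λ d → m * d + 0ℤ) (det-expand (topLeft M)) ⟨
  m * det (suc k) (topLeft M) + 0ℤ
    ≡⟨ ℤP.+-identityʳ _ ⟩
  m * det (suc k) (topLeft M)
    ∎
  where
  open ≡-Reasoning
  m : ℤ
  m = M (fromℕ (suc k)) (fromℕ (suc k))
  T : Fin (suc (suc k)) → ℤ
  T j = sgn j * M zero j * det (suc k) (minor M j)
  T-last : T (fromℕ (suc k)) ≡ 0ℤ
  T-last = trans (cong (sgn (fromℕ (suc k)) * M zero (fromℕ (suc k)) *_)
                   (det-zeroRow (suc k) (fromℕ k) (minor M (fromℕ (suc k)))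
                     (λ y → trans (cong (M (fromℕ (suc k))) (punchIn-fromℕ y)) (lastRow≡0 y))))
                 (ℤP.*-zeroʳ (sgn (fromℕ (suc k)) * M zero (fromℕ (suc k))))
  T-inject₁ : ∀ j → T (inject₁ j) ≡ m * (sgn j * topLeft M zero j * det k (minor (topLeft M) j))
  T-inject₁ j = begin
    sgn (inject₁ j) * M zero (inject₁ j) * det (suc k) (minor M (inject₁ j))
      ≡⟨ cong₂ (λ s d → sign s * M zero (inject₁ j) * d)
               (toℕ-inject₁ j) (det-lastRowDiagonal k (minor M (inject₁ j)) minor-lastRow≡0) ⟩
    sgn j * M zero (inject₁ j) * (minor M (inject₁ j) (fromℕ k) (fromℕ k) * det k (topLeft (minor M (inject₁ j))))
      ≡⟨ cong₂ (λ c d → sgn j * M zero (inject₁ j) * (M (fromℕ (suc k)) c * d))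
               (punchIn-inject₁-fromℕ k j) (det-cong k (λ x y → cong (M (suc (inject₁ x))) (punchIn-inject₁ j y))) ⟩
    sgn j * M zero (inject₁ j) * (m * det k (minor (topLeft M) j))
      ≡⟨ swap (sgn j) (M zero (inject₁ j)) m (det k (minor (topLeft M) j)) ⟩
    m * (sgn j * M zero (inject₁ j) * det k (minor (topLeft M) j))
      ∎
    where
    minor-lastRow≡0 : ∀ y → minor M (inject₁ j) (fromℕ k) (inject₁ y) ≡ 0ℤ
    minor-lastRow≡0 y = trans (cong (M (fromℕ (suc k))) (punchIn-inject₁ j y)) (lastRow≡0 (punchIn j y))
    swap : ∀ s a m d → s * a * (m * d) ≡ m * (s * a * d)
    swap = solve-∀

det-peelLastRow : ∀ k (M : Matrix (suc k)) (s : Fin k) (β : ℤ) →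
  (∀ y → M (fromℕ k) y ≡ β * (δ (fromℕ k) y - δ (inject₁ s) y)) →
  det (suc k) M ≡ β * det k (λ x y → M (inject₁ x) (inject₁ y) + δ y s * M (inject₁ x) (fromℕ k))
det-peelLastRow k M s β lastRow = begin
  det (suc k) M                ≡⟨ det-colOp (suc k) S L 1ℤ (L≢S ∘ sym) (setCol-here M S colS) (setCol-there M S colS) ⟨
  det (suc k) M′               ≡⟨ det-lastRowDiagonal k M′ M′-lastRow≡0 ⟩
  M′ L L * det k (topLeft M′)  ≡⟨ cong₂ _*_ M′-corner (det-cong k topLeft-M′) ⟩
  β * det k (λ x y → M (inject₁ x) (inject₁ y) + δ y s * M (inject₁ x) (fromℕ k)) ∎
  where
  open ≡-Reasoning
  L : Fin (suc k)
  L = fromℕ k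
  S : Fin (suc k)
  S = inject₁ s
  L≢S : L ≢ S
  L≢S = fromℕ≢inject₁
  colS : Fin (suc k) → ℤ
  colS x = M x S + 1ℤ * M x L
  M′ : Matrix (suc k)
  M′ = setCol M S colS
  M′-lastRow≡0 : ∀ y → M′ L (inject₁ y) ≡ 0ℤ
  M′-lastRow≡0 y with y ≟ᶠ s
  ... | yes refl = begin
    M′ L S                                             ≡⟨ setCol-here M S colS L ⟩
    M L S + 1ℤ * M L L                                 ≡⟨ cong₂ (λ a b → a + 1ℤ * b) (lastRow S) (lastRow L) ⟩
    β * (δ L S - δ S S) + 1ℤ * (β * (δ L L - δ S L))
      ≡⟨ cong₂ (λ a b → β * (a - δ S S) + 1ℤ * (β * (δ L L - b))) (δ-≢ L≢S) (δ-≢ (L≢S ∘ sym)) ⟩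
    β * (0ℤ - δ S S) + 1ℤ * (β * (δ L L - 0ℤ))
      ≡⟨ cong₂ (λ a b → β * (0ℤ - a) + 1ℤ * (β * (b - 0ℤ))) (δ-refl S) (δ-refl L) ⟩
    β * (0ℤ - 1ℤ) + 1ℤ * (β * (1ℤ - 0ℤ))               ≡⟨ cancel β ⟩
    0ℤ                                                 ∎
    where
    cancel : ∀ b → b * (0ℤ - 1ℤ) + 1ℤ * (b * (1ℤ - 0ℤ)) ≡ 0ℤ
    cancel = solve-∀
  ... | no y≢s = begin
    M′ L (inject₁ y)                         ≡⟨ setCol-there M S colS L (inject₁ y) (y≢s ∘ inject₁-injective) ⟩
    M L (inject₁ y)                          ≡⟨ lastRow (inject₁ y) ⟩
    β * (δ L (inject₁ y) - δ S (inject₁ y))  ≡⟨ cong₂ (λ a b → β * (a - b)) (δ-≢ {a = L} (fromℕ≢inject₁ {i = y}))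
                                                                           (δ-≢ {a = S} (y≢s ∘ sym ∘ inject₁-injective)) ⟩
    β * (0ℤ - 0ℤ)                            ≡⟨ ℤP.*-zeroʳ β ⟩
    0ℤ                                       ∎
  M′-corner : M′ L L ≡ β
  M′-corner = begin
    M′ L L                  ≡⟨ setCol-there M S colS L L L≢S ⟩
    M L L                   ≡⟨ lastRow L ⟩
    β * (δ L L - δ S L)     ≡⟨ cong₂ (λ a b → β * (a - b)) (δ-refl L) (δ-≢ (L≢S ∘ sym)) ⟩
    β * (1ℤ - 0ℤ)           ≡⟨ ℤP.*-identityʳ β ⟩
    β                       ∎
  topLeft-M′ : ∀ x y → topLeft M′ x y ≡ M (inject₁ x) (inject₁ y) + δ y s * M (inject₁ x) L
  topLeft-M′ x y with y ≟ᶠ s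
  ... | yes refl rewrite setCol-here M S colS (inject₁ x) | δ-refl y = refl
  ... | no y≢s
    rewrite setCol-there M S colS (inject₁ x) (inject₁ y) (y≢s ∘ inject₁-injective)
          | δ-≢ y≢s
          | ℤP.*-zeroˡ (M (inject₁ x) L) = sym (ℤP.+-identityʳ _)

det-peel : ∀ k (M : Matrix (suc k)) (s : Fin k) (β : ℤ) →
  (∀ y → M (fromℕ k) y - M (inject₁ s) y ≡ β * (δ (fromℕ k) y - δ (inject₁ s) y)) →
  det (suc k) M ≡ β * det k (λ x y → M (inject₁ x) (inject₁ y) + δ y s * M (inject₁ x) (fromℕ k))
det-peel k M s β rowL-rowS = begin
  det (suc k) M
    ≡⟨ det-rowOp (suc k) L S -1ℤ fromℕ≢inject₁ M′-rowL M′-others ⟨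
  det (suc k) M′
    ≡⟨ det-peelLastRow k M′ s β (λ y → trans (M′-rowL y) (trans (cong (λ z → M L y + z) (ℤP.-1*i≡-i (M S y))) (rowL-rowS y))) ⟩
  β * det k (λ x y → M′ (inject₁ x) (inject₁ y) + δ y s * M′ (inject₁ x) L)
    ≡⟨ cong (β *_) (det-cong k λ x y → cong₂ (λ a b → a + δ y s * b)
                     (M′-others (inject₁ x) (inject₁ y) (fromℕ≢inject₁ ∘ sym))
                     (M′-others (inject₁ x) L (fromℕ≢inject₁ ∘ sym))) ⟩
  β * det k (λ x y → M (inject₁ x) (inject₁ y) + δ y s * M (inject₁ x) L)
    ∎
  where
  open ≡-Reasoning
  L : Fin (suc k)
  L = fromℕ k
  S : Fin (suc k)
  S = inject₁ s
  M′ : Matrix (suc k)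
  M′ = updateAt M L (λ _ y → M L y + -1ℤ * M S y)
  M′-rowL : ∀ y → M′ L y ≡ M L y + -1ℤ * M S y
  M′-rowL y = cong (λ r → r y) (updateAt-updates L M)
  M′-others : ∀ x y → x ≢ L → M′ x y ≡ M x y
  M′-others x y x≢L = cong (λ r → r y) (updateAt-minimal x L M x≢L)

-- A formula in ℕ-indices defines a matrix of every size, which lets the peeling steps shrink the size freely.
matrix : (k : ℕ) → (ℕ → ℕ → ℤ) → Matrix k
matrix k F x y = F (toℕ x) (toℕ y)

det-matrix-cong : ∀ k {F G : ℕ → ℕ → ℤ} → (∀ x y → x < k → y < k → F x y ≡ G x y) →
  det k (matrix k F) ≡ det k (matrix k G)
det-matrix-cong k F≡G = det-cong k (λ x y → F≡G (toℕ x) (toℕ y) (toℕ<n x) (toℕ<n y))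

det-matrix-size : ∀ {k k′} (F : ℕ → ℕ → ℤ) → k ≡ k′ → det k (matrix k F) ≡ det k′ (matrix k′ F)
det-matrix-size F refl = refl

det-peelℕ : ∀ k (F : ℕ → ℕ → ℤ) (s : ℕ) → s < k → (β : ℤ) →
  (∀ y → y < suc k → F k y - F s y ≡ β * (δℕ k y - δℕ s y)) →
  det (suc k) (matrix (suc k) F) ≡ β * det k (matrix k (λ x y → F x y + δℕ y s * F x k))
det-peelℕ k F s s<k β rowk-rows =
  trans (det-peel k (matrix (suc k) F) S β hyp) (cong (β *_) (det-cong k entries))
  where
  S : Fin k
  S = fromℕ< s<k
  toℕ-S : toℕ S ≡ s
  toℕ-S = toℕ-fromℕ< s<k
  toℕ-inject₁-S : toℕ (inject₁ S) ≡ s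
  toℕ-inject₁-S = trans (toℕ-inject₁ S) toℕ-S
  hyp : ∀ y → matrix (suc k) F (fromℕ k) y - matrix (suc k) F (inject₁ S) y ≡ β * (δ (fromℕ k) y - δ (inject₁ S) y)
  hyp y rewrite toℕ-fromℕ k | toℕ-inject₁-S = rowk-rows (toℕ y) (toℕ<n y)
  entries : ∀ x y → matrix (suc k) F (inject₁ x) (inject₁ y) + δ y S * matrix (suc k) F (inject₁ x) (fromℕ k)
                  ≡ F (toℕ x) (toℕ y) + δℕ (toℕ y) s * F (toℕ x) k
  entries x y rewrite toℕ-inject₁ x | toℕ-inject₁ y | toℕ-fromℕ k | toℕ-S = refl

-- Distances in the unitary addition Cayley graph

anyFin-true : ∀ n (f : Fin n → Bool) (c : Fin n) → f c ≡ true → anyFin n f ≡ true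
anyFin-true (suc n) f zero    fc≡true rewrite fc≡true = refl
anyFin-true (suc n) f (suc c) fc≡true rewrite anyFin-true n (λ i → f (suc i)) c fc≡true = ∨-zeroʳ (f zero)

anyFin-false : ∀ n (f : Fin n → Bool) → (∀ c → f c ≡ false) → anyFin n f ≡ false
anyFin-false zero    f _        = refl
anyFin-false (suc n) f f≡false rewrite f≡false zero = anyFin-false n (λ i → f (suc i)) (λ c → f≡false (suc c))

≟-refl : ∀ {n} (a : Fin n) → ⌊ a ≟ᶠ a ⌋ ≡ true
≟-refl a with a ≟ᶠ a
... | yes _  = refl
... | no a≢a = ⊥-elim (a≢a refl)

≟-≢ : ∀ {n} {a b : Fin n} → a ≢ b → ⌊ a ≟ᶠ b ⌋ ≡ false
≟-≢ {a = a} {b} a≢b with a ≟ᶠ b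
... | yes a≡b = ⊥-elim (a≢b a≡b)
... | no _    = refl

reach₁-adj : ∀ n (a b : Fin n) → adj n a b ≡ true → reach n 1 a b ≡ true
reach₁-adj n a b ab =
  trans (cong (⌊ a ≟ᶠ b ⌋ ∨_) (anyFin-true n (λ c → ⌊ a ≟ᶠ c ⌋ ∧ adj n c b) a (cong₂ _∧_ (≟-refl a) ab))) (∨-zeroʳ _)

reach₁-nonadj : ∀ n (a b : Fin n) → a ≢ b → adj n a b ≡ false → reach n 1 a b ≡ false
reach₁-nonadj n a b a≢b ab =
  cong₂ _∨_ (≟-≢ a≢b) (anyFin-false n (λ c → ⌊ a ≟ᶠ c ⌋ ∧ adj n c b) via-c)
  where
  via-c : ∀ c → ⌊ a ≟ᶠ c ⌋ ∧ adj n c b ≡ false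
  via-c c with a ≟ᶠ c
  ... | yes refl = ab
  ... | no _     = refl

reach₂-via : ∀ n (a b c : Fin n) → adj n a c ≡ true → adj n c b ≡ true → reach n 2 a b ≡ true
reach₂-via n a b c ac cb =
  trans (cong (reach n 1 a b ∨_) (anyFin-true n (λ c → reach n 1 a c ∧ adj n c b) c (cong₂ _∧_ (reach₁-adj n a c ac) cb))) (∨-zeroʳ _)

dist-self : ∀ n (a : Fin n) → dist n a a ≡ 0
dist-self (suc n) a rewrite ≟-refl a = refl

dist-adj : ∀ n (a b : Fin n) → a ≢ b → adj n a b ≡ true → dist n a b ≡ 1
dist-adj (suc zero)    zero zero a≢b _ = ⊥-elim (a≢b refl)
dist-adj (suc (suc n)) a    b    a≢b ab rewrite reach₁-adj (suc (suc n)) a b ab | ≟-≢ a≢b = refl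

dist-common-neighbour : ∀ n (a b c : Fin n) → 3 ≤ n → a ≢ b → adj n a b ≡ false →
  adj n a c ≡ true → adj n c b ≡ true → dist n a b ≡ 2
dist-common-neighbour (suc (suc (suc n))) a b c (s≤s (s≤s (s≤s _))) a≢b ab ac cb
  rewrite reach₂-via (suc (suc (suc n))) a b c ac cb | reach₁-nonadj (suc (suc (suc n))) a b a≢b ab | ≟-≢ a≢b = refl

-- The hypotheses say that suc k is a power of p (its divisors other than 1 are multiples of p).
module PrimePowerDistances (p k : ℕ) (3≤p : 3 ≤ p) (p∣N : p ∣ suc k)
                           (divisor : ∀ d → d ∣ suc k → d ≡ 1 ⊎ p ∣ d) where

  N : ℕ
  N = suc k

  isUnit-p∤ : ∀ s → ¬ p ∣ s → isUnit N s ≡ true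
  isUnit-p∤ s p∤s with gcd (s % N) N ℕ.≟ 1
  ... | yes _ = refl
  ... | no g≢1 with divisor (gcd (s % N) N) (gcd[m,n]∣n (s % N) N)
  ...   | inj₁ g≡1 = ⊥-elim (g≢1 g≡1)
  ...   | inj₂ p∣g = ⊥-elim (p∤s (∣n∣m%n⇒∣m p∣N (∣-trans p∣g (gcd[m,n]∣m (s % N) N))))

  isUnit-p∣ : ∀ s → p ∣ s → isUnit N s ≡ false
  isUnit-p∣ s p∣s with gcd (s % N) N ℕ.≟ 1
  ... | no _    = refl
  ... | yes g≡1 = ⊥-elim (ℕP.<⇒≢ (ℕP.≤-trans (s≤s (s≤s z≤n)) 3≤p)
                             (sym (∣1⇒≡1 (subst (p ∣_) g≡1 (gcd-greatest (%-presˡ-∣ p∣s p∣N) p∣N)))))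

  adj-p∤ : ∀ (a c : Fin N) → a ≢ c → ¬ p ∣ toℕ a ℕ.+ toℕ c → adj N a c ≡ true
  adj-p∤ a c a≢c p∤ rewrite ≟-≢ a≢c = isUnit-p∤ _ p∤

  adj-p∣ : ∀ (a c : Fin N) → p ∣ toℕ a ℕ.+ toℕ c → adj N a c ≡ false
  adj-p∣ a c p∣ rewrite isUnit-p∣ _ p∣ = ∧-zeroʳ _

  private
    p∤1 : ¬ p ∣ 1
    p∤1 p∣1 = ℕP.<⇒≱ (ℕP.<-≤-trans (s≤s (s≤s z≤n)) 3≤p) (∣⇒≤ p∣1)

    p∤2 : ¬ p ∣ 2
    p∤2 p∣2 = ℕP.<⇒≱ 3≤p (∣⇒≤ p∣2)

    p∣-shiftʳ : ∀ x c d → p ∣ x ℕ.+ c → p ∣ x ℕ.+ (c ℕ.+ d) → p ∣ d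
    p∣-shiftʳ x c d p∣x+c p∣x+c+d = ∣m+n∣m⇒∣n (subst (p ∣_) (sym (ℕP.+-assoc x c d)) p∣x+c+d) p∣x+c

    p∣-shiftˡ : ∀ y c d → p ∣ c ℕ.+ y → p ∣ (c ℕ.+ d) ℕ.+ y → p ∣ d
    p∣-shiftˡ y c d p∣c+y p∣c+d+y =
      p∣-shiftʳ y c d (subst (p ∣_) (ℕP.+-comm c y) p∣c+y) (subst (p ∣_) (ℕP.+-comm (c ℕ.+ d) y) p∣c+d+y)

    Bad : ℕ → ℕ → ℕ → Set
    Bad x y c = p ∣ x ℕ.+ c ⊎ p ∣ c ℕ.+ y

    -- Each of x and y rules out at most one of three consecutive candidates.
    not-all-bad : ∀ x y → Bad x y 0 → Bad x y 1 → Bad x y 2 → ⊥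
    not-all-bad x y (inj₁ b₀) (inj₁ b₁) _         = p∤1 (p∣-shiftʳ x 0 1 b₀ b₁)
    not-all-bad x y (inj₂ b₀) (inj₂ b₁) _         = p∤1 (p∣-shiftˡ y 0 1 b₀ b₁)
    not-all-bad x y (inj₁ b₀) (inj₂ _)  (inj₁ b₂) = p∤2 (p∣-shiftʳ x 0 2 b₀ b₂)
    not-all-bad x y (inj₁ _)  (inj₂ b₁) (inj₂ b₂) = p∤1 (p∣-shiftˡ y 1 1 b₁ b₂)
    not-all-bad x y (inj₂ _)  (inj₁ b₁) (inj₁ b₂) = p∤1 (p∣-shiftʳ x 1 1 b₁ b₂)
    not-all-bad x y (inj₂ b₀) (inj₁ _)  (inj₂ b₂) = p∤2 (p∣-shiftˡ y 0 2 b₀ b₂)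

    bad? : ∀ x y c → (¬ p ∣ x ℕ.+ c × ¬ p ∣ c ℕ.+ y) ⊎ Bad x y c
    bad? x y c with p ∣? x ℕ.+ c | p ∣? c ℕ.+ y
    ... | no p∤x+c | no p∤c+y = inj₁ (p∤x+c , p∤c+y)
    ... | yes p∣x+c | _       = inj₂ (inj₁ p∣x+c)
    ... | no _     | yes p∣c+y = inj₂ (inj₂ p∣c+y)

  good-candidate : ∀ x y → Σ ℕ λ c → c < 3 × ¬ p ∣ x ℕ.+ c × ¬ p ∣ c ℕ.+ y
  good-candidate x y with bad? x y 0 | bad? x y 1 | bad? x y 2
  ... | inj₁ (g , g′) | _             | _             = 0 , s≤s z≤n , g , g′
  ... | inj₂ _        | inj₁ (g , g′) | _             = 1 , s≤s (s≤s z≤n) , g , g′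
  ... | inj₂ _        | inj₂ _        | inj₁ (g , g′) = 2 , ℕP.≤-refl , g , g′
  ... | inj₂ b₀       | inj₂ b₁       | inj₂ b₂       = ⊥-elim (not-all-bad x y b₀ b₁ b₂)

  3≤N : 3 ≤ N
  3≤N = ℕP.≤-trans 3≤p (∣⇒≤ p∣N)

  dist-p∤ : ∀ (a b : Fin N) → a ≢ b → ¬ p ∣ toℕ a ℕ.+ toℕ b → dist N a b ≡ 1
  dist-p∤ a b a≢b p∤ = dist-adj N a b a≢b (adj-p∤ a b a≢b p∤)

  dist-p∣ : ∀ (a b : Fin N) → a ≢ b → p ∣ toℕ a ℕ.+ toℕ b → dist N a b ≡ 2
  dist-p∣ a b a≢b p∣ with good-candidate (toℕ a) (toℕ b)
  ... | c , c<3 , p∤a+c , p∤c+b =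
    dist-common-neighbour N a b C 3≤N a≢b (adj-p∣ a b p∣) (adj-p∤ a C a≢C p∤a+C) (adj-p∤ C b C≢b p∤C+b)
    where
    C : Fin N
    C = fromℕ< (ℕP.<-≤-trans c<3 3≤N)
    toℕ-C : toℕ C ≡ c
    toℕ-C = toℕ-fromℕ< (ℕP.<-≤-trans c<3 3≤N)
    p∤a+C : ¬ p ∣ toℕ a ℕ.+ toℕ C
    p∤a+C rewrite toℕ-C = p∤a+c
    p∤C+b : ¬ p ∣ toℕ C ℕ.+ toℕ b
    p∤C+b rewrite toℕ-C = p∤c+b
    a≢C : a ≢ C
    a≢C refl = p∤C+b p∣
    C≢b : C ≢ b
    C≢b refl = p∤a+C p∣

-- The determinant of t I − D

prod : ℕ → (ℕ → ℤ) → ℤ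
prod zero    f = 1ℤ
prod (suc n) f = f n * prod n f

prod-+ : ∀ m n (f : ℕ → ℤ) → prod (m ℕ.+ n) f ≡ prod m (λ i → f (i ℕ.+ n)) * prod n f
prod-+ zero    n f = sym (ℤP.*-identityˡ (prod n f))
prod-+ (suc m) n f = trans (cong (f (m ℕ.+ n) *_) (prod-+ m n f)) (sym (ℤP.*-assoc (f (m ℕ.+ n)) _ (prod n f)))

prod-cong : ∀ n {f g : ℕ → ℤ} → (∀ i → i < n → f i ≡ g i) → prod n f ≡ prod n g
prod-cong zero    f≡g = refl
prod-cong (suc n) f≡g = cong₂ _*_ (f≡g n ℕP.≤-refl) (prod-cong n (λ i i<n → f≡g i (ℕP.m<n⇒m<1+n i<n)))

even≢odd : ∀ l k → l ℕ.+ l ≢ suc (k ℕ.+ k)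
even≢odd zero    k       ()
even≢odd (suc l) zero    eq = ℕP.1+n≢0 (trans (sym (ℕP.+-suc l l)) (ℕP.suc-injective eq))
even≢odd (suc l) (suc k) eq = even≢odd l k (ℕP.suc-injective (ℕP.suc-injective
  (trans (sym (ℕP.+-suc (suc l) l)) (trans eq (cong suc (ℕP.+-suc (suc k) k))))))

module CharacteristicMatrix (h₀ q₀ : ℕ) (t : ℤ) where

  h : ℕ
  h = suc h₀

  p : ℕ
  p = suc (h ℕ.+ h)

  q : ℕ
  q = suc q₀

  -- For a ≢ b, d (a + b) is the distance between a and b in the unitary addition Cayley graph on ℤ_(q p).
  d : ℕ → ℤ
  d z = if ⌊ p ∣? z ⌋ then + 2 else + 1

  d-p∣ : ∀ z → p ∣ z → d z ≡ + 2
  d-p∣ z p∣z with p ∣? z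
  ... | yes _   = refl
  ... | no p∤z  = ⊥-elim (p∤z p∣z)

  d-p∤ : ∀ z → ¬ p ∣ z → d z ≡ + 1
  d-p∤ z p∤z with p ∣? z
  ... | yes p∣z = ⊥-elim (p∤z p∣z)
  ... | no _    = refl

  d-periodic : ∀ z → d (p ℕ.+ z) ≡ d z
  d-periodic z with p ∣? p ℕ.+ z | p ∣? z
  ... | yes _     | yes _     = refl
  ... | no _      | no _      = refl
  ... | yes p∣p+z | no p∤z    = ⊥-elim (p∤z (∣m+n∣m⇒∣n p∣p+z (n∣n {p})))
  ... | no p∤p+z  | yes p∣z   = ⊥-elim (p∤p+z (∣m∣n⇒∣m+n (n∣n {p}) p∣z))

  d-between : ∀ z → 0 < z → z < p ℕ.+ p → z ≢ p → d z ≡ + 1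
  d-between z 0<z z<2p z≢p with p ∣? z
  ... | no _ = refl
  ... | yes (divides zero          z≡0)    = ⊥-elim (ℕP.<⇒≢ 0<z (sym z≡0))
  ... | yes (divides (suc zero)    z≡p)    = ⊥-elim (z≢p (trans z≡p (ℕP.+-identityʳ p)))
  ... | yes (divides (suc (suc k)) z≡kp)   =
    ⊥-elim (ℕP.<⇒≱ z<2p (subst (p ℕ.+ p ≤_) (sym z≡kp) (ℕP.+-monoʳ-≤ p (ℕP.m≤m+n p (k ℕ.* p)))))

  α : ℕ → ℤ
  α a = t + d (a ℕ.+ a)

  α-periodic : ∀ a → α (a ℕ.+ p) ≡ α a
  α-periodic a = cong (λ z → t + z) (trans (cong d (shift a p)) (trans (d-periodic (p ℕ.+ (a ℕ.+ a))) (d-periodic (a ℕ.+ a))))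
    where
    shift : ∀ a p → a ℕ.+ p ℕ.+ (a ℕ.+ p) ≡ p ℕ.+ (p ℕ.+ (a ℕ.+ a))
    shift = ℕSolver.solve-∀

  -- The entries of t I − D, with − d (a + a) on the diagonal compensated inside α a.
  charMatrix : ℕ → ℕ → ℤ
  charMatrix a b = δℕ a b * α a - d (a ℕ.+ b)

  -- Once the indices ≥ k are gone, a column b among the last p remaining ones carries the columns
  -- b + p, b + 2 p, … < q p of its residue class: q − b / p columns in all.
  multiplicity : ℕ → ℕ → ℤ
  multiplicity k b = if ⌊ k ℕ.≤? b ℕ.+ p ⌋ then + q - + (b / p) else 1ℤ

  folded : ℕ → ℕ → ℕ → ℤ
  folded k a b = δℕ a b * α a - d (a ℕ.+ b) * multiplicity k b

  multiplicity-last : ∀ k b → k ≤ b ℕ.+ p → multiplicity k b ≡ + q - + (b / p)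
  multiplicity-last k b k≤b+p with k ℕ.≤? b ℕ.+ p
  ... | yes _ = refl
  ... | no k≰b+p = ⊥-elim (k≰b+p k≤b+p)

  multiplicity-earlier : ∀ k b → ¬ k ≤ b ℕ.+ p → multiplicity k b ≡ 1ℤ
  multiplicity-earlier k b k≰b+p with k ℕ.≤? b ℕ.+ p
  ... | yes k≤b+p = ⊥-elim (k≰b+p k≤b+p)
  ... | no _      = refl

  multiplicity-step : ∀ j b → b ≢ j → multiplicity (suc (j ℕ.+ p)) b ≡ multiplicity (j ℕ.+ p) b
  multiplicity-step j b b≢j with suc (j ℕ.+ p) ℕ.≤? b ℕ.+ p | j ℕ.+ p ℕ.≤? b ℕ.+ p
  ... | yes _   | yes _   = refl
  ... | no _    | no _    = refl
  ... | yes k<  | no k≰   = ⊥-elim (k≰ (ℕP.≤-trans (ℕP.n≤1+n _) k<))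
  ... | no k≮   | yes k≤  = ⊥-elim (b≢j (ℕP.+-cancelʳ-≡ p b j (ℕP.≤-antisym (ℕP.≮⇒≥ k≮) k≤)))

  d-shiftʳ : ∀ a b → d (a ℕ.+ (b ℕ.+ p)) ≡ d (a ℕ.+ b)
  d-shiftʳ a b = trans (cong d (shift a b p)) (d-periodic (a ℕ.+ b))
    where
    shift : ∀ a b p → a ℕ.+ (b ℕ.+ p) ≡ p ℕ.+ (a ℕ.+ b)
    shift = ℕSolver.solve-∀

  d-shiftˡ : ∀ a b → d (a ℕ.+ p ℕ.+ b) ≡ d (a ℕ.+ b)
  d-shiftˡ a b = trans (cong d (shift a p b)) (d-periodic (a ℕ.+ b))
    where
    shift : ∀ a p b → a ℕ.+ p ℕ.+ b ≡ p ℕ.+ (a ℕ.+ b)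
    shift = ℕSolver.solve-∀

  /p-step : ∀ j → (j ℕ.+ p) / p ≡ suc (j / p)
  /p-step j = trans (+-distrib-/-∣ʳ j (n∣n {p})) (trans (cong (j / p ℕ.+_) (n/n≡1 p)) (ℕP.+-comm (j / p) 1))

  -- Row j + p equals row j off the diagonal, so it can be peeled off against row j.
  fold-step : ∀ j → det (suc (j ℕ.+ p)) (matrix _ (folded (suc (j ℕ.+ p))))
                  ≡ α j * det (j ℕ.+ p) (matrix _ (folded (j ℕ.+ p)))
  fold-step j = trans (det-peelℕ K (folded (suc K)) j (ℕP.m<m+n j (s≤s z≤n)) (α j) rows)
                      (cong (α j *_) (det-matrix-cong K entries))
    where
    K : ℕ
    K = j ℕ.+ p
    rows : ∀ y → y < suc K → folded (suc K) K y - folded (suc K) j y ≡ α j * (δℕ K y - δℕ j y)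
    rows y _ rewrite α-periodic j | d-shiftˡ j y = alg (δℕ K y) (δℕ j y) (α j) (d (j ℕ.+ y)) (multiplicity (suc K) y)
      where
      alg : ∀ a b x g w → a * x - g * w - (b * x - g * w) ≡ x * (a - b)
      alg = solve-∀
    entries : ∀ x y → x < K → y < K → folded (suc K) x y + δℕ y j * folded (suc K) x K ≡ folded K x y
    entries x y x<K y<K with y ℕ.≟ j
    ... | yes refl
      rewrite δℕ-≢ (ℕP.<⇒≢ x<K) | d-shiftʳ x y
            | multiplicity-last (suc K) K (ℕP.m<m+n K (s≤s z≤n))
            | multiplicity-earlier (suc K) y (ℕP.<⇒≱ (ℕP.≤-refl {suc K}))
            | multiplicity-last K y (ℕP.≤-refl {K})
            | /p-step y = alg (δℕ x y) (α x) (d (x ℕ.+ y)) (+ q) (+ (y / p))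
      where
      alg : ∀ e a g Q v → e * a - g * 1ℤ + 1ℤ * (0ℤ * a - g * (Q - (1ℤ + v))) ≡ e * a - g * (Q - v)
      alg = solve-∀
    ... | no y≢j rewrite multiplicity-step j y y≢j
      = trans (cong (λ z → folded K x y + z) (ℤP.*-zeroˡ (folded (suc K) x K))) (ℤP.+-identityʳ _)

  fold : ∀ j → det (j ℕ.+ p) (matrix _ (folded (j ℕ.+ p))) ≡ prod j α * det p (matrix p (folded p))
  fold zero    = sym (ℤP.*-identityˡ _)
  fold (suc j) = trans (fold-step j) (trans (cong (α j *_) (fold j)) (sym (ℤP.*-assoc (α j) (prod j α) _)))

  -- What is left after folding: each column carries all q columns of its residue class.
  reduced : ℕ → ℕ → ℤ
  reduced a b = δℕ a b * α a - d (a ℕ.+ b) * + q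

  multiplicity-start : ∀ b → b < q₀ ℕ.* p ℕ.+ p → multiplicity (q₀ ℕ.* p ℕ.+ p) b ≡ 1ℤ
  multiplicity-start b b<qp with q₀ ℕ.* p ℕ.+ p ℕ.≤? b ℕ.+ p
  ... | no _ = refl
  ... | yes qp≤b+p = trans (cong (λ z → + q - + z) b/p≡q₀) (suc-minus q₀)
    where
    suc-minus : ∀ a → + suc a - + a ≡ 1ℤ
    suc-minus a = trans (cong (λ z → z - + a) (ℤP.pos-+ 1 a)) (cancel (+ a))
      where
      cancel : ∀ x → 1ℤ + x - x ≡ 1ℤ
      cancel = solve-∀
    b/p<q : b / p < q
    b/p<q = m<n*o⇒m/o<n (subst (b <_) (ℕP.+-comm (q₀ ℕ.* p) p) b<qp)
    q₀≤b/p : q₀ ≤ b / p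
    q₀≤b/p = subst (_≤ b / p) (m*n/n≡m q₀ p) (/-monoˡ-≤ p (ℕP.+-cancelʳ-≤ p (q₀ ℕ.* p) b qp≤b+p))
    b/p≡q₀ : b / p ≡ q₀
    b/p≡q₀ = ℕP.≤-antisym (ℕP.≤-pred b/p<q) q₀≤b/p

  multiplicity-p : ∀ b → b < p → multiplicity p b ≡ + q
  multiplicity-p b b<p rewrite multiplicity-last p b (ℕP.m≤n+m p b) | m<n⇒m/n≡0 b<p = ℤP.+-identityʳ (+ q)

  det-charMatrix≡det-reduced : det (q₀ ℕ.* p ℕ.+ p) (matrix _ charMatrix) ≡ prod (q₀ ℕ.* p) α * det p (matrix p reduced)
  det-charMatrix≡det-reduced = begin
    det (q₀ ℕ.* p ℕ.+ p) (matrix _ charMatrix)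
      ≡⟨ det-matrix-cong _ (λ x y _ y< → cong (λ w → δℕ x y * α x - w)
           (trans (sym (ℤP.*-identityʳ (d (x ℕ.+ y)))) (cong (d (x ℕ.+ y) *_) (sym (multiplicity-start y y<))))) ⟩
    det (q₀ ℕ.* p ℕ.+ p) (matrix _ (folded (q₀ ℕ.* p ℕ.+ p)))
      ≡⟨ fold (q₀ ℕ.* p) ⟩
    prod (q₀ ℕ.* p) α * det p (matrix p (folded p))
      ≡⟨ cong (prod (q₀ ℕ.* p) α *_)
              (det-matrix-cong p (λ x y _ y< → cong (λ w → δℕ x y * α x - d (x ℕ.+ y) * w) (multiplicity-p y y<))) ⟩
    prod (q₀ ℕ.* p) α * det p (matrix p reduced)
      ∎
    where open ≡-Reasoning

  α-0 : α 0 ≡ t + + 2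
  α-0 = cong (λ z → t + z) (d-p∣ 0 (divides 0 refl))

  α-unit : ∀ l → 0 < l → l < p → α l ≡ t + 1ℤ
  α-unit l 0<l l<p = cong (λ z → t + z)
    (d-between (l ℕ.+ l) (ℕP.<-≤-trans 0<l (ℕP.m≤m+n l l)) (ℕP.+-mono-< l<p l<p) (even≢odd l h))

  α-periodic* : ∀ e l → α (l ℕ.+ e ℕ.* p) ≡ α l
  α-periodic* zero    l = cong α (ℕP.+-identityʳ l)
  α-periodic* (suc e) l = trans (cong α (reassoc l p (e ℕ.* p))) (trans (α-periodic (l ℕ.+ e ℕ.* p)) (α-periodic* e l))
    where
    reassoc : ∀ a b c → a ℕ.+ (b ℕ.+ c) ≡ a ℕ.+ c ℕ.+ b
    reassoc = ℕSolver.solve-∀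

  prod-α-initial : ∀ i → i < p → prod (suc i) α ≡ (t + 1ℤ) ^ i * (t + + 2)
  prod-α-initial zero    _     = trans (cong (_* 1ℤ) α-0) (trans (ℤP.*-identityʳ _) (sym (ℤP.*-identityˡ _)))
  prod-α-initial (suc i) i+1<p = begin
    α (suc i) * prod (suc i) α
      ≡⟨ cong₂ _*_ (α-unit (suc i) (s≤s z≤n) i+1<p) (prod-α-initial i (ℕP.<-trans (ℕP.n<1+n i) i+1<p)) ⟩
    (t + 1ℤ) * ((t + 1ℤ) ^ i * (t + + 2))         ≡⟨ ℤP.*-assoc (t + 1ℤ) ((t + 1ℤ) ^ i) (t + + 2) ⟨
    (t + 1ℤ) ^ suc i * (t + + 2)                  ∎
    where open ≡-Reasoning

  prod-α-blocks : ∀ e → prod (e ℕ.* p) α ≡ (t + + 2) ^ e * (t + 1ℤ) ^ ((h ℕ.+ h) ℕ.* e)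
  prod-α-blocks zero    = sym (trans (ℤP.*-identityˡ _) (cong ((t + 1ℤ) ^_) (ℕP.*-zeroʳ (h ℕ.+ h))))
  prod-α-blocks (suc e) = begin
    prod (p ℕ.+ e ℕ.* p) α
      ≡⟨ prod-+ p (e ℕ.* p) α ⟩
    prod p (λ i → α (i ℕ.+ e ℕ.* p)) * prod (e ℕ.* p) α
      ≡⟨ cong₂ _*_ (trans (prod-cong p (λ i _ → α-periodic* e i)) (prod-α-initial (h ℕ.+ h) ℕP.≤-refl)) (prod-α-blocks e) ⟩
    (t + 1ℤ) ^ (h ℕ.+ h) * (t + + 2) * ((t + + 2) ^ e * (t + 1ℤ) ^ ((h ℕ.+ h) ℕ.* e))
      ≡⟨ regroup (t + + 2) ((t + 1ℤ) ^ (h ℕ.+ h)) ((t + + 2) ^ e) ((t + 1ℤ) ^ ((h ℕ.+ h) ℕ.* e)) ⟩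
    (t + + 2) ^ suc e * ((t + 1ℤ) ^ (h ℕ.+ h) * (t + 1ℤ) ^ ((h ℕ.+ h) ℕ.* e))
      ≡⟨ cong ((t + + 2) ^ suc e *_) (trans (sym (ℤP.^-distribˡ-+-* (t + 1ℤ) (h ℕ.+ h) ((h ℕ.+ h) ℕ.* e)))
                                             (cong ((t + 1ℤ) ^_) (sym (ℕP.*-suc (h ℕ.+ h) e)))) ⟩
    (t + + 2) ^ suc e * (t + 1ℤ) ^ ((h ℕ.+ h) ℕ.* suc e)
      ∎
    where
    open ≡-Reasoning
    regroup : ∀ a b c e → b * a * (c * e) ≡ a * c * (b * e)
    regroup = solve-∀

  reduced-generic : ∀ a b → b ≢ a → 0 < a ℕ.+ b → a ℕ.+ b < p ℕ.+ p → a ℕ.+ b ≢ p → reduced a b ≡ - + q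
  reduced-generic a b b≢a 0<a+b a+b<2p a+b≢p rewrite δℕ-≢ (b≢a ∘ sym) | d-between (a ℕ.+ b) 0<a+b a+b<2p a+b≢p =
    alg (α a) (+ q)
    where
    alg : ∀ x Q → 0ℤ * x - + 1 * Q ≡ - Q
    alg = solve-∀

  reduced-complement : ∀ a b → a ≢ b → a ℕ.+ b ≡ p → reduced a b ≡ - (+ 2 * + q)
  reduced-complement a b a≢b a+b≡p rewrite δℕ-≢ a≢b | d-p∣ (a ℕ.+ b) (subst (p ∣_) (sym a+b≡p) (n∣n {p})) = alg (α a) (+ q)
    where
    alg : ∀ x Q → 0ℤ * x - + 2 * Q ≡ - (+ 2 * Q)
    alg = solve-∀

  reduced-diagonal : ∀ a → 0 < a → a < p → reduced a a ≡ t + 1ℤ - + q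
  reduced-diagonal a 0<a a<p rewrite δℕ-refl a | α-unit a 0<a a<p
    | d-between (a ℕ.+ a) (ℕP.<-≤-trans 0<a (ℕP.m≤m+n a a)) (ℕP.+-mono-< a<p a<p) (even≢odd a h) = alg t (+ q)
    where
    alg : ∀ t Q → 1ℤ * (t + 1ℤ) - + 1 * Q ≡ t + 1ℤ - Q
    alg = solve-∀

  -- mirrored r y = 1 iff 1 ≤ y ≤ r: these columns y have absorbed their mirror column p − y.
  mirrored : ℕ → ℕ → ℤ
  mirrored r zero    = 0ℤ
  mirrored r (suc y) = if ⌊ y ℕ.<? r ⌋ then 1ℤ else 0ℤ

  mirrored-≤ : ∀ r y → y < r → mirrored r (suc y) ≡ 1ℤ
  mirrored-≤ r y y<r with y ℕ.<? r
  ... | yes _   = refl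
  ... | no y≮r  = ⊥-elim (y≮r y<r)

  mirrored-> : ∀ r y → ¬ y < r → mirrored r (suc y) ≡ 0ℤ
  mirrored-> r y y≮r with y ℕ.<? r
  ... | yes y<r = ⊥-elim (y≮r y<r)
  ... | no _    = refl

  mirrored-step : ∀ r y → y ≢ suc r → mirrored r y ≡ mirrored (suc r) y
  mirrored-step r zero    _ = refl
  mirrored-step r (suc y) y≢r+1 with y ℕ.<? r | y ℕ.<? suc r
  ... | yes _   | yes _     = refl
  ... | no _    | no _      = refl
  ... | yes y<r | no y≮r+1  = ⊥-elim (y≮r+1 (ℕP.m<n⇒m<1+n y<r))
  ... | no y≮r  | yes y<r+1 = ⊥-elim (y≢r+1 (cong suc (ℕP.≤-antisym (ℕP.≤-pred y<r+1) (ℕP.≮⇒≥ y≮r))))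

  mirrored-beyond : ∀ r k → suc r < k → mirrored r k ≡ 0ℤ
  mirrored-beyond r (suc k) (s≤s r<k) = mirrored-> r k (ℕP.<-asym r<k)

  paired : ℕ → ℕ → ℕ → ℤ
  paired r x y = reduced x y + mirrored r y * reduced x (p ∸ y)

  β : ℤ
  β = t + 1ℤ + + q

  paired-unmirrored : ∀ r x y → mirrored r y ≡ 0ℤ → paired r x y ≡ reduced x y
  paired-unmirrored r x y unmirrored =
    trans (cong (λ m → reduced x y + m * reduced x (p ∸ y)) unmirrored) (ℤP.+-identityʳ (reduced x y))

  -- For K + s = p, rows K and s of paired r agree except in the columns s and K themselves.
  module PairStep (r K : ℕ) (s<K : suc r < K) (K+s≡p : K ℕ.+ suc r ≡ p) where

    open ≡-Reasoning

    s : ℕ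
    s = suc r

    K<p : K < p
    K<p = subst (K <_) K+s≡p (ℕP.m<m+n K (s≤s z≤n))

    s<p : s < p
    s<p = ℕP.<-trans s<K K<p

    0<K : 0 < K
    0<K = ℕP.<-trans (s≤s z≤n) s<K

    p∸s≡K : p ∸ s ≡ K
    p∸s≡K = trans (cong (_∸ s) (sym K+s≡p)) (ℕP.m+n∸n≡m K s)

    pair-generic : ∀ b → b ≤ p → b ≢ s → b ≢ K → reduced K b ≡ - + q × reduced s b ≡ - + q
    pair-generic b b≤p b≢s b≢K =
      reduced-generic K b b≢K (ℕP.<-≤-trans 0<K (ℕP.m≤m+n K b)) (ℕP.+-mono-<-≤ K<p b≤p)
        (λ K+b≡p → b≢s (ℕP.+-cancelˡ-≡ K b s (trans K+b≡p (sym K+s≡p)))) ,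
      reduced-generic s b b≢s (s≤s z≤n) (ℕP.+-mono-<-≤ s<p b≤p)
        (λ s+b≡p → b≢K (ℕP.+-cancelˡ-≡ s b K (trans s+b≡p (sym (trans (ℕP.+-comm s K) K+s≡p)))))

    s-unmirrored : mirrored r s ≡ 0ℤ
    s-unmirrored = mirrored-> r r (ℕP.n≮n r)

    K-unmirrored : mirrored r K ≡ 0ℤ
    K-unmirrored = mirrored-beyond r K s<K

    mirror≢s : ∀ b → b ≤ p → b ≢ K → p ∸ b ≢ s
    mirror≢s b b≤p b≢K p∸b≡s = b≢K (ℕP.+-cancelʳ-≡ s b K
      (trans (subst (λ c → b ℕ.+ c ≡ p) p∸b≡s (ℕP.m+[n∸m]≡n b≤p)) (sym K+s≡p)))

    mirror≢K : ∀ b → b ≤ p → b ≢ s → p ∸ b ≢ K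
    mirror≢K b b≤p b≢s p∸b≡K = b≢s (ℕP.+-cancelʳ-≡ K b s
      (trans (subst (λ c → b ℕ.+ c ≡ p) p∸b≡K (ℕP.m+[n∸m]≡n b≤p)) (sym (trans (ℕP.+-comm s K) K+s≡p))))

    mirror-equal : ∀ y → y ≤ p → y ≢ s → y ≢ K → mirrored r y * reduced K (p ∸ y) ≡ mirrored r y * reduced s (p ∸ y)
    mirror-equal zero    _   _   _   = trans (ℤP.*-zeroˡ (reduced K p)) (sym (ℤP.*-zeroˡ (reduced s p)))
    mirror-equal (suc y) y≤p y≢s y≢K with y ℕ.<? r
    ... | no _ = trans (ℤP.*-zeroˡ (reduced K (p ∸ suc y))) (sym (ℤP.*-zeroˡ (reduced s (p ∸ suc y))))
    ... | yes _ = cong (1ℤ *_) (trans (proj₁ generic) (sym (proj₂ generic)))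
      where
      generic : reduced K (p ∸ suc y) ≡ - + q × reduced s (p ∸ suc y) ≡ - + q
      generic = pair-generic (p ∸ suc y) (ℕP.m∸n≤m p (suc y)) (mirror≢s (suc y) y≤p y≢K) (mirror≢K (suc y) y≤p y≢s)

    rows-s : paired r K s - paired r s s ≡ β * (δℕ K s - δℕ s s)
    rows-s = begin
      paired r K s - paired r s s
        ≡⟨ cong₂ _-_ (paired-unmirrored r K s s-unmirrored) (paired-unmirrored r s s s-unmirrored) ⟩
      reduced K s - reduced s s
        ≡⟨ cong₂ _-_ (reduced-complement K s (ℕP.<⇒≢ s<K ∘ sym) K+s≡p) (reduced-diagonal s (s≤s z≤n) s<p) ⟩
      - (+ 2 * + q) - (t + 1ℤ - + q)
        ≡⟨ alg t (+ q) ⟩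
      β * (0ℤ - 1ℤ)
        ≡⟨ cong₂ (λ a b → β * (a - b)) (δℕ-≢ (ℕP.<⇒≢ s<K ∘ sym)) (δℕ-refl s) ⟨
      β * (δℕ K s - δℕ s s)
        ∎
      where
      alg : ∀ t Q → - (+ 2 * Q) - (t + 1ℤ - Q) ≡ (t + 1ℤ + Q) * (0ℤ - 1ℤ)
      alg = solve-∀

    rows-K : paired r K K - paired r s K ≡ β * (δℕ K K - δℕ s K)
    rows-K = begin
      paired r K K - paired r s K
        ≡⟨ cong₂ _-_ (paired-unmirrored r K K K-unmirrored) (paired-unmirrored r s K K-unmirrored) ⟩
      reduced K K - reduced s K
        ≡⟨ cong₂ _-_ (reduced-diagonal K 0<K K<p) (reduced-complement s K (ℕP.<⇒≢ s<K) (trans (ℕP.+-comm s K) K+s≡p)) ⟩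
      t + 1ℤ - + q - - (+ 2 * + q)
        ≡⟨ alg t (+ q) ⟩
      β * (1ℤ - 0ℤ)
        ≡⟨ cong₂ (λ a b → β * (a - b)) (δℕ-refl K) (δℕ-≢ (ℕP.<⇒≢ s<K)) ⟨
      β * (δℕ K K - δℕ s K)
        ∎
      where
      alg : ∀ t Q → t + 1ℤ - Q - - (+ 2 * Q) ≡ (t + 1ℤ + Q) * (1ℤ - 0ℤ)
      alg = solve-∀

    rows-other : ∀ y → y ≤ p → y ≢ s → y ≢ K → paired r K y - paired r s y ≡ β * (δℕ K y - δℕ s y)
    rows-other y y≤p y≢s y≢K = begin
      reduced K y + mirrored r y * reduced K (p ∸ y) - (reduced s y + mirrored r y * reduced s (p ∸ y))
        ≡⟨ cong₂ (λ a b → a + b - (reduced s y + mirrored r y * reduced s (p ∸ y)))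
                 (trans (proj₁ generic) (sym (proj₂ generic))) (mirror-equal y y≤p y≢s y≢K) ⟩
      reduced s y + mirrored r y * reduced s (p ∸ y) - (reduced s y + mirrored r y * reduced s (p ∸ y))
        ≡⟨ ℤP.+-inverseʳ (reduced s y + mirrored r y * reduced s (p ∸ y)) ⟩
      0ℤ
        ≡⟨ ℤP.*-zeroʳ β ⟨
      β * 0ℤ
        ≡⟨ cong₂ (λ a b → β * (a - b)) (δℕ-≢ (y≢K ∘ sym)) (δℕ-≢ (y≢s ∘ sym)) ⟨
      β * (δℕ K y - δℕ s y)
        ∎
      where
      generic : reduced K y ≡ - + q × reduced s y ≡ - + q
      generic = pair-generic y y≤p y≢s y≢K

    rows : ∀ y → y < suc K → paired r K y - paired r s y ≡ β * (δℕ K y - δℕ s y)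
    rows y y≤K with y ℕ.≟ s | y ℕ.≟ K
    ... | yes refl | _        = rows-s
    ... | no _     | yes refl = rows-K
    ... | no y≢s   | no y≢K   = rows-other y (ℕP.≤-trans (ℕP.≤-pred y≤K) (ℕP.<⇒≤ K<p)) y≢s y≢K

    entries : ∀ x y → x < K → y < K → paired r x y + δℕ y s * paired r x K ≡ paired s x y
    entries x y _ _ with y ℕ.≟ s
    ... | yes refl
      rewrite s-unmirrored | K-unmirrored | mirrored-≤ s r (ℕP.n<1+n r) | p∸s≡K =
      alg (reduced x s) (reduced x K) (reduced x (p ∸ K))
      where
      alg : ∀ a b c → a + 0ℤ * b + 1ℤ * (b + 0ℤ * c) ≡ a + 1ℤ * b
      alg = solve-∀
    ... | no y≢s rewrite mirrored-step r y y≢s = alg (reduced x y) (mirrored s y) (reduced x (p ∸ y)) (paired r x K)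
      where
      alg : ∀ a i b c → a + i * b + 0ℤ * c ≡ a + i * b
      alg = solve-∀

    pair-step : det (suc K) (matrix _ (paired r)) ≡ β * det K (matrix K (paired s))
    pair-step = trans (det-peelℕ K (paired r) s s<K β rows) (cong (β *_) (det-matrix-cong K entries))

  pair-all : ∀ v r → r ℕ.+ v ≡ h → det (suc (h ℕ.+ v)) (matrix _ (paired r)) ≡ β ^ v * det (suc h) (matrix _ (paired h))
  pair-all zero    r r+0≡h = begin
    det (suc (h ℕ.+ 0)) (matrix _ (paired r)) ≡⟨ det-matrix-size (paired r) (cong suc (ℕP.+-identityʳ h)) ⟩
    det (suc h) (matrix _ (paired r))         ≡⟨ cong (λ r → det (suc h) (matrix _ (paired r))) (trans (sym (ℕP.+-identityʳ r)) r+0≡h) ⟩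
    det (suc h) (matrix _ (paired h))         ≡⟨ ℤP.*-identityˡ _ ⟨
    1ℤ * det (suc h) (matrix _ (paired h))    ∎
    where open ≡-Reasoning
  pair-all (suc v) r r+v+1≡h = begin
    det (suc (h ℕ.+ suc v)) (matrix _ (paired r))        ≡⟨ PairStep.pair-step r (h ℕ.+ suc v) s<K K+s≡p ⟩
    β * det (h ℕ.+ suc v) (matrix _ (paired (suc r)))    ≡⟨ cong (β *_) (det-matrix-size (paired (suc r)) (ℕP.+-suc h v)) ⟩
    β * det (suc (h ℕ.+ v)) (matrix _ (paired (suc r)))  ≡⟨ cong (β *_) (pair-all v (suc r) (trans (sym (ℕP.+-suc r v)) r+v+1≡h)) ⟩
    β * (β ^ v * det (suc h) (matrix _ (paired h)))      ≡⟨ ℤP.*-assoc β (β ^ v) _ ⟨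
    β ^ suc v * det (suc h) (matrix _ (paired h))        ∎
    where
    open ≡-Reasoning
    r<h : r < h
    r<h = subst (r <_) r+v+1≡h (ℕP.m<m+n r (s≤s z≤n))
    s<K : suc r < h ℕ.+ suc v
    s<K = ℕP.<-≤-trans (s≤s r<h) (subst (_≤ h ℕ.+ suc v) (ℕP.+-comm h 1) (ℕP.+-monoʳ-≤ h (s≤s z≤n)))
    K+s≡p : h ℕ.+ suc v ℕ.+ suc r ≡ p
    K+s≡p = trans (regroup h v r) (cong (λ z → suc (h ℕ.+ z)) r+v+1≡h)
      where
      regroup : ∀ h v r → h ℕ.+ suc v ℕ.+ suc r ≡ suc (h ℕ.+ (r ℕ.+ suc v))
      regroup = ℕSolver.solve-∀

  paired-0 : ∀ x y → paired 0 x y ≡ reduced x y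
  paired-0 x zero    = paired-unmirrored 0 x zero refl
  paired-0 x (suc y) = paired-unmirrored 0 x (suc y) (mirrored-> 0 y (λ ()))

  sx<p : ∀ {x} → x < h → suc x < p
  sx<p x<h = s≤s (ℕP.≤-trans x<h (ℕP.m≤m+n h h))

  sum<2p : ∀ {a b} → a < p → b ≤ p → a ℕ.+ b < p ℕ.+ p
  sum<2p = ℕP.+-mono-<-≤

  mirror-sum : ∀ y → y < h → suc y ℕ.+ (p ∸ suc y) ≡ p
  mirror-sum y y<h = ℕP.m+[n∸m]≡n (ℕP.<⇒≤ (sx<p y<h))

  mirror<p : ∀ y → y < h → p ∸ suc y < p
  mirror<p y y<h = ℕP.∸-monoʳ-< (s≤s z≤n) (ℕP.<⇒≤ (sx<p y<h))

  mirror≢0 : ∀ y → y < h → p ∸ suc y ≢ 0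
  mirror≢0 y y<h m≡0 = ℕP.<⇒≢ (sx<p y<h) (trans (sym (ℕP.+-identityʳ (suc y))) (trans (cong (suc y ℕ.+_) (sym m≡0)) (mirror-sum y y<h)))

  sx≢mirror : ∀ x y → x < h → y < h → suc x ≢ p ∸ suc y
  sx≢mirror x y x<h y<h eq = ℕP.<⇒≢ (s≤s (ℕP.+-mono-≤ y<h x<h)) (trans (cong (suc y ℕ.+_) eq) (mirror-sum y y<h))

  pairedEnd : ℕ → ℕ → ℤ
  pairedEnd zero    zero    = t + + 2 - + 2 * + q
  pairedEnd (suc x) zero    = - + q
  pairedEnd zero    (suc y) = - (+ 2 * + q)
  pairedEnd (suc x) (suc y) = δℕ x y * (t + 1ℤ - + q) - + 2 * + q

  paired-end-interior : ∀ x y → x < h → y < h → paired h (suc x) (suc y) ≡ pairedEnd (suc x) (suc y)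
  paired-end-interior x y x<h y<h rewrite mirrored-≤ h y y<h with x ℕ.≟ y
  ... | yes refl = begin
    reduced (suc x) (suc x) + 1ℤ * reduced (suc x) (p ∸ suc x)
      ≡⟨ cong₂ (λ a b → a + 1ℤ * b) (reduced-diagonal (suc x) (s≤s z≤n) (sx<p x<h))
                                      (reduced-complement (suc x) (p ∸ suc x) (sx≢mirror x x x<h x<h) (mirror-sum x x<h)) ⟩
    t + 1ℤ - + q + 1ℤ * - (+ 2 * + q)
      ≡⟨ alg t (+ q) ⟩
    1ℤ * (t + 1ℤ - + q) - + 2 * + q
      ∎
    where
    open ≡-Reasoning
    alg : ∀ t Q → t + 1ℤ - Q + 1ℤ * - (+ 2 * Q) ≡ 1ℤ * (t + 1ℤ - Q) - + 2 * Q
    alg = solve-∀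
  ... | no x≢y = begin
    reduced (suc x) (suc y) + 1ℤ * reduced (suc x) (p ∸ suc y)
      ≡⟨ cong₂ (λ a b → a + 1ℤ * b)
           (reduced-generic (suc x) (suc y) (x≢y ∘ sym ∘ ℕP.suc-injective) (s≤s z≤n) (sum<2p (sx<p x<h) (ℕP.<⇒≤ (sx<p y<h)))
              (ℕP.<⇒≢ (s≤s (ℕP.+-mono-≤ x<h y<h))))
           (reduced-generic (suc x) (p ∸ suc y) (sx≢mirror x y x<h y<h ∘ sym) (s≤s z≤n) (sum<2p (sx<p x<h) (ℕP.m∸n≤m p (suc y)))
              (λ eq → x≢y (ℕP.suc-injective (ℕP.+-cancelʳ-≡ (p ∸ suc y) (suc x) (suc y) (trans eq (sym (mirror-sum y y<h))))))) ⟩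
    - + q + 1ℤ * - + q
      ≡⟨ alg t (+ q) ⟩
    0ℤ * (t + 1ℤ - + q) - + 2 * + q
      ∎
    where
    open ≡-Reasoning
    alg : ∀ t Q → - Q + 1ℤ * - Q ≡ 0ℤ * (t + 1ℤ - Q) - + 2 * Q
    alg = solve-∀

  paired-end : ∀ x y → x < suc h → y < suc h → paired h x y ≡ pairedEnd x y
  paired-end zero zero _ _ rewrite d-p∣ 0 (divides 0 refl) = alg t (+ q) (reduced 0 p)
    where
    alg : ∀ t Q z → 1ℤ * (t + + 2) - + 2 * Q + 0ℤ * z ≡ t + + 2 - + 2 * Q
    alg = solve-∀
  paired-end (suc x) zero (s≤s x<h) _ =
    trans (paired-unmirrored h (suc x) 0 refl)
          (reduced-generic (suc x) 0 (λ ()) (s≤s z≤n) (sum<2p (sx<p x<h) z≤n) (ℕP.<⇒≢ (+0<p (sx<p x<h))))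
    where
    +0<p : ∀ {a} → a < p → a ℕ.+ 0 < p
    +0<p {a} a<p = subst (_< p) (sym (ℕP.+-identityʳ a)) a<p
  paired-end zero (suc y) _ (s≤s y<h) rewrite mirrored-≤ h y y<h = begin
    reduced 0 (suc y) + 1ℤ * reduced 0 (p ∸ suc y)
      ≡⟨ cong₂ (λ a b → a + 1ℤ * b)
           (reduced-generic 0 (suc y) (λ ()) (s≤s z≤n) (sum<2p (s≤s z≤n) (ℕP.<⇒≤ (sx<p y<h))) (ℕP.<⇒≢ (sx<p y<h)))
           (reduced-generic 0 (p ∸ suc y) (mirror≢0 y y<h) (ℕP.n≢0⇒n>0 (mirror≢0 y y<h))
              (sum<2p (s≤s z≤n) (ℕP.m∸n≤m p (suc y))) (ℕP.<⇒≢ (mirror<p y y<h))) ⟩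
    - + q + 1ℤ * - + q
      ≡⟨ alg (+ q) ⟩
    - (+ 2 * + q)
      ∎
    where
    open ≡-Reasoning
    alg : ∀ Q → - Q + 1ℤ * - Q ≡ - (+ 2 * Q)
    alg = solve-∀
  paired-end (suc x) (suc y) (s≤s x<h) (s≤s y<h) = paired-end-interior x y x<h y<h

  β′ : ℤ
  β′ = t + 1ℤ - + q

  -- Column 1 has absorbed the r columns peeled off so far, each of them constant −2 q.
  merged : ℕ → ℕ → ℕ → ℤ
  merged r x y = pairedEnd x y - δℕ y 1 * (+ r * (+ 2 * + q))

  merged-last : ∀ r v x → x < suc (suc v) → merged r x (suc (suc v)) ≡ - (+ 2 * + q)
  merged-last r v zero    _ = alg (+ q) (+ r * (+ 2 * + q))
    where
    alg : ∀ Q R → - (+ 2 * Q) - 0ℤ * R ≡ - (+ 2 * Q)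
    alg = solve-∀
  merged-last r v (suc x) (s≤s x<v+1) rewrite δℕ-≢ (ℕP.<⇒≢ x<v+1) = alg t (+ q) (+ r * (+ 2 * + q))
    where
    alg : ∀ t Q R → 0ℤ * (t + 1ℤ - Q) - + 2 * Q - 0ℤ * R ≡ - (+ 2 * Q)
    alg = solve-∀

  merge-step : ∀ r v → det (suc (suc (suc v))) (matrix _ (merged r)) ≡ β′ * det (suc (suc v)) (matrix _ (merged (suc r)))
  merge-step r v = trans (det-peelℕ (suc (suc v)) (merged r) 1 (s≤s (s≤s z≤n)) β′ rows) (cong (β′ *_) (det-matrix-cong _ entries))
    where
    rows : ∀ y → y < suc (suc (suc v)) → merged r (suc (suc v)) y - merged r 1 y ≡ β′ * (δℕ (suc (suc v)) y - δℕ 1 y)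
    rows zero    _ = alg (+ q) (+ r * (+ 2 * + q)) β′
      where
      alg : ∀ Q R B → - Q - 0ℤ * R - (- Q - 0ℤ * R) ≡ B * (0ℤ - 0ℤ)
      alg = solve-∀
    rows (suc y) _ rewrite δℕ-suc (suc v) y | δℕ-suc 0 y | δℕ-suc y 0 =
      alg (δℕ (suc v) y) (δℕ 0 y) (δℕ y 0) β′ (+ q) (+ r * (+ 2 * + q))
      where
      alg : ∀ a b c B Q R → a * B - + 2 * Q - c * R - (b * B - + 2 * Q - c * R) ≡ B * (a - b)
      alg = solve-∀
    entries : ∀ x y → x < suc (suc v) → y < suc (suc v) → merged r x y + δℕ y 1 * merged r x (suc (suc v)) ≡ merged (suc r) x y
    entries x y x<v+2 _ rewrite merged-last r v x x<v+2 | ℤP.pos-+ 1 r = alg (pairedEnd x y) (δℕ y 1) (+ r) (+ q)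
      where
      alg : ∀ Y e R Q → Y - e * (R * (+ 2 * Q)) + e * - (+ 2 * Q) ≡ Y - e * ((+ 1 + R) * (+ 2 * Q))
      alg = solve-∀

  merge-all : ∀ v r → det (suc (suc v)) (matrix _ (merged r)) ≡ β′ ^ v * det 2 (matrix 2 (merged (r ℕ.+ v)))
  merge-all zero    r rewrite ℕP.+-identityʳ r = sym (ℤP.*-identityˡ _)
  merge-all (suc v) r rewrite ℕP.+-suc r v =
    trans (merge-step r v) (trans (cong (β′ *_) (merge-all v (suc r))) (sym (ℤP.*-assoc β′ (β′ ^ v) _)))

  det-2×2 : ∀ (F : ℕ → ℕ → ℤ) → det 2 (matrix 2 F) ≡ F 0 0 * F 1 1 - F 0 1 * F 1 0
  det-2×2 F = alg (F 0 0) (F 0 1) (F 1 0) (F 1 1)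
    where
    alg : ∀ a b c d → 1ℤ * a * (1ℤ * d * 1ℤ + 0ℤ) + (- 1ℤ * b * (1ℤ * c * 1ℤ + 0ℤ) + 0ℤ) ≡ a * d - b * c
    alg = solve-∀

  final2×2 : ℤ
  final2×2 = merged h₀ 0 0 * merged h₀ 1 1 - merged h₀ 0 1 * merged h₀ 1 0

  det-reduced : det p (matrix p reduced) ≡ β ^ h * (β′ ^ h₀ * final2×2)
  det-reduced = begin
    det p (matrix p reduced)                     ≡⟨ det-matrix-cong p (λ x y _ _ → sym (paired-0 x y)) ⟩
    det p (matrix p (paired 0))                  ≡⟨ pair-all h 0 refl ⟩
    β ^ h * det (suc h) (matrix _ (paired h))    ≡⟨ cong (β ^ h *_) (det-matrix-cong (suc h) λ x y x≤h y≤h →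
                                                       trans (paired-end x y x≤h y≤h) (sym (merged-0 x y))) ⟩
    β ^ h * det (suc h) (matrix _ (merged 0))    ≡⟨ cong (β ^ h *_) (merge-all h₀ 0) ⟩
    β ^ h * (β′ ^ h₀ * det 2 (matrix 2 (merged h₀))) ≡⟨ cong (λ z → β ^ h * (β′ ^ h₀ * z)) (det-2×2 (merged h₀)) ⟩
    β ^ h * (β′ ^ h₀ * final2×2)                 ∎
    where
    open ≡-Reasoning
    merged-0 : ∀ x y → merged 0 x y ≡ pairedEnd x y
    merged-0 x y = alg (pairedEnd x y) (δℕ y 1) (+ q)
      where
      alg : ∀ Y e Q → Y - e * (+ 0 * (+ 2 * Q)) ≡ Y
      alg = solve-∀

-- The characteristic polynomial

prime-power-divisor : ∀ p → Prime p → ∀ j d → d ∣ p ℕ.^ j → d ≡ 1 ⊎ p ∣ d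
prime-power-divisor p p-prime zero    d d∣1 = inj₁ (∣1⇒≡1 d∣1)
prime-power-divisor p p-prime (suc j) d d∣pʲ⁺¹ with p ∣? d
... | yes p∣d = inj₂ p∣d
... | no p∤d  = prime-power-divisor p p-prime j d (coprime-divisor d⊥p d∣pʲ⁺¹)
  where
  d⊥p : Coprime d p
  d⊥p (c∣d , c∣p) with prime⇒irreducible p-prime c∣p
  ... | inj₁ c≡1 = c≡1
  ... | inj₂ refl = ⊥-elim (p∤d c∣d)

odd⇒double+1 : ∀ n → ¬ 2 ∣ n → Σ ℕ λ h → n ≡ suc (h ℕ.+ h)
odd⇒double+1 zero             2∤n = ⊥-elim (2∤n (divides 0 refl))
odd⇒double+1 (suc zero)       _   = 0 , refl
odd⇒double+1 (suc (suc n)) 2∤n+2 with odd⇒double+1 n (2∤n+2 ∘ step)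
  where
  step : 2 ∣ n → 2 ∣ suc (suc n)
  step (divides k n≡2k) = divides (suc k) (cong (λ k → suc (suc k)) n≡2k)
... | h , n≡2h+1 = suc h , cong (λ k → suc (suc k)) (trans n≡2h+1 (sym (ℕP.+-suc h h)))

half-double : ∀ n → (n ℕ.+ n) / 2 ≡ n
half-double n = trans (cong (_/ 2) (trans (cong (n ℕ.+_) (sym (ℕP.+-identityʳ n))) (ℕP.*-comm 2 n))) (m*n/n≡m n 2)

-- The right-hand side of the theorem, written with q = p^(m − 1) (so that p^m = p q) and N² = p^(2 m).
spectrumPolynomial : ℕ → ℕ → ℕ → ℤ → ℤ
spectrumPolynomial p q N² t =
  (t + + 1 + + q) ^ ((p ∸ 1) / 2)
  * (t + + 2) ^ (q ∸ 1)
  * (t + + 1) ^ ((p ∸ 1) ℕ.* (q ∸ 1))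
  * (t - + (q ∸ 1)) ^ ((p ∸ 3) / 2)
  * ((+ 2 * t - (+ (p ℕ.* q) + + 2 * + q - + 3)) ^ 2
     - (+ N² + + 2 * + (p ℕ.* q) - + 4 * + q + + 1))

module ClosedForm (h₀ q₀ : ℕ) (t : ℤ) where

  open CharacteristicMatrix h₀ q₀ t

  N : ℕ
  N = p ℕ.* q

  3≤p : 3 ℕ.≤ p
  3≤p = s≤s (s≤s (ℕP.≤-trans (s≤s z≤n) (ℕP.m≤n+m h h₀)))

  dist≡d : (∀ c → c ∣ N → c ≡ 1 ⊎ p ∣ c) → ∀ (i j : Fin N) → i ≢ j → + dist N i j ≡ d (toℕ i ℕ.+ toℕ j)
  dist≡d divisor i j i≢j with p ∣? toℕ i ℕ.+ toℕ j
  ... | yes p∣ = cong +_ (dist-p∣ i j i≢j p∣)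
    where
    open PrimePowerDistances p (q₀ ℕ.+ (h ℕ.+ h) ℕ.* q) 3≤p (divides q (ℕP.*-comm p q)) divisor using (dist-p∣)
  ... | no p∤  = cong +_ (dist-p∤ i j i≢j p∤)
    where
    open PrimePowerDistances p (q₀ ℕ.+ (h ℕ.+ h) ℕ.* q) 3≤p (divides q (ℕP.*-comm p q)) divisor using (dist-p∤)

  charPoly≡det-charMatrix : (∀ c → c ∣ N → c ≡ 1 ⊎ p ∣ c) →
    charPolyAt N (distMatrix N) t ≡ det (q₀ ℕ.* p ℕ.+ p) (matrix _ charMatrix)
  charPoly≡det-charMatrix divisor =
    trans (det-cong N entry) (det-matrix-size charMatrix (trans (ℕP.*-comm p q) (ℕP.+-comm p (q₀ ℕ.* p))))
    where
    entry : ∀ i j → (if ⌊ i ≟ᶠ j ⌋ then t else + 0) - + dist N i j ≡ charMatrix (toℕ i) (toℕ j)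
    entry i j = by-cases (i ≟ᶠ j)
      where
      open ≡-Reasoning
      by-cases : Dec (i ≡ j) → (if ⌊ i ≟ᶠ j ⌋ then t else + 0) - + dist N i j ≡ charMatrix (toℕ i) (toℕ j)
      by-cases (yes refl) = begin
        (if ⌊ i ≟ᶠ i ⌋ then t else + 0) - + dist N i i
          ≡⟨ cong₂ (λ b n → (if b then t else + 0) - + n) (≟-refl i) (dist-self N i) ⟩
        t - + 0
          ≡⟨ alg t (d (toℕ i ℕ.+ toℕ i)) ⟩
        1ℤ * α (toℕ i) - d (toℕ i ℕ.+ toℕ i)
          ≡⟨ cong (λ e → e * α (toℕ i) - d (toℕ i ℕ.+ toℕ i)) (δℕ-refl (toℕ i)) ⟨
        charMatrix (toℕ i) (toℕ i)
          ∎
        where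
        alg : ∀ t e → t - + 0 ≡ 1ℤ * (t + e) - e
        alg = solve-∀
      by-cases (no i≢j) = begin
        (if ⌊ i ≟ᶠ j ⌋ then t else + 0) - + dist N i j
          ≡⟨ cong₂ (λ b n → (if b then t else + 0) - n) (≟-≢ i≢j) (dist≡d divisor i j i≢j) ⟩
        + 0 - d (toℕ i ℕ.+ toℕ j)
          ≡⟨ alg (α (toℕ i)) (d (toℕ i ℕ.+ toℕ j)) ⟩
        0ℤ * α (toℕ i) - d (toℕ i ℕ.+ toℕ j)
          ≡⟨ cong (λ e → e * α (toℕ i) - d (toℕ i ℕ.+ toℕ j)) (δℕ-≢ (i≢j ∘ toℕ-injective)) ⟨
        charMatrix (toℕ i) (toℕ j)
          ∎
        where
        alg : ∀ a e → + 0 - e ≡ 0ℤ * a - e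
        alg = solve-∀

  +p≡1+2h : + p ≡ 1ℤ + (1ℤ + + h₀) + (1ℤ + + h₀)
  +p≡1+2h = trans (ℤP.pos-+ 1 (h ℕ.+ h)) (cong (λ z → 1ℤ + z) (trans (ℤP.pos-+ h h) (cong₂ _+_ (ℤP.pos-+ 1 h₀) (ℤP.pos-+ 1 h₀))))

  quadratic : + 4 * final2×2 ≡ (+ 2 * t - (+ N + + 2 * + q - + 3)) ^ 2 - (+ (N ℕ.* N) + + 2 * + N - + 4 * + q + + 1)
  quadratic rewrite ℤP.pos-* N N | ℤP.pos-* p q | +p≡1+2h = identity t (+ h₀) (+ q)
    where
    identity : ∀ t a c → + 4 * ((t + + 2 - + 2 * c - + 0 * (a * (+ 2 * c))) * (1ℤ * (t + 1ℤ - c) - + 2 * c - 1ℤ * (a * (+ 2 * c)))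
                                - (- (+ 2 * c) - 1ℤ * (a * (+ 2 * c))) * (- c - + 0 * (a * (+ 2 * c))))
      ≡ (+ 2 * t - ((1ℤ + (1ℤ + a) + (1ℤ + a)) * c + + 2 * c - + 3)) * ((+ 2 * t - ((1ℤ + (1ℤ + a) + (1ℤ + a)) * c + + 2 * c - + 3)) * 1ℤ)
        - ((1ℤ + (1ℤ + a) + (1ℤ + a)) * c * ((1ℤ + (1ℤ + a) + (1ℤ + a)) * c) + + 2 * ((1ℤ + (1ℤ + a) + (1ℤ + a)) * c) - + 4 * c + + 1)
    identity = solve-∀

  charPoly-closedForm : (∀ c → c ∣ N → c ≡ 1 ⊎ p ∣ c) → + 4 * charPolyAt N (distMatrix N) t ≡ spectrumPolynomial p q (N ℕ.* N) t
  charPoly-closedForm divisor = begin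
    + 4 * charPolyAt N (distMatrix N) t
      ≡⟨ cong (+ 4 *_) (trans (charPoly≡det-charMatrix divisor) det-charMatrix≡det-reduced) ⟩
    + 4 * (prod (q₀ ℕ.* p) α * det p (matrix p reduced))
      ≡⟨ cong (λ z → + 4 * z) (cong₂ _*_ (prod-α-blocks q₀) det-reduced) ⟩
    + 4 * ((t + + 2) ^ q₀ * (t + 1ℤ) ^ ((h ℕ.+ h) ℕ.* q₀) * (β ^ h * (β′ ^ h₀ * final2×2)))
      ≡⟨ regroup ((t + + 2) ^ q₀) ((t + 1ℤ) ^ ((h ℕ.+ h) ℕ.* q₀)) (β ^ h) (β′ ^ h₀) final2×2 ⟩
    β ^ h * (t + + 2) ^ q₀ * (t + 1ℤ) ^ ((h ℕ.+ h) ℕ.* q₀) * β′ ^ h₀ * (+ 4 * final2×2)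
      ≡⟨ cong₂ (λ b Q → β ^ h * (t + + 2) ^ q₀ * (t + 1ℤ) ^ ((h ℕ.+ h) ℕ.* q₀) * b ^ h₀ * Q) β′≡t-q₀ quadratic ⟩
    β ^ h * (t + + 2) ^ q₀ * (t + 1ℤ) ^ ((h ℕ.+ h) ℕ.* q₀) * (t - + q₀) ^ h₀
      * ((+ 2 * t - (+ N + + 2 * + q - + 3)) ^ 2 - (+ (N ℕ.* N) + + 2 * + N - + 4 * + q + + 1))
      ≡⟨ cong₂ (λ e e′ → (t + + 1 + + q) ^ e * (t + + 2) ^ q₀ * (t + 1ℤ) ^ ((h ℕ.+ h) ℕ.* q₀) * (t - + q₀) ^ e′
                           * ((+ 2 * t - (+ N + + 2 * + q - + 3)) ^ 2 - (+ (N ℕ.* N) + + 2 * + N - + 4 * + q + + 1)))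
               (half-double h) (trans (cong (λ z → (z ∸ 1) / 2) (ℕP.+-suc h₀ h₀)) (half-double h₀)) ⟨
    spectrumPolynomial p q (N ℕ.* N) t
      ∎
    where
    open ≡-Reasoning
    regroup : ∀ A B C E D → + 4 * (A * B * (C * (E * D))) ≡ C * A * B * E * (+ 4 * D)
    regroup = solve-∀
    β′≡t-q₀ : β′ ≡ t - + q₀
    β′≡t-q₀ = trans (cong (λ z → t + 1ℤ - z) (ℤP.pos-+ 1 q₀)) (cancel t (+ q₀))
      where
      cancel : ∀ t x → t + 1ℤ - (1ℤ + x) ≡ t - x
      cancel = solve-∀

mainTheorem13 : (p m : ℕ) → Prime p → ¬ (2 ∣ p) → m ≥ 1 →
    (t : ℤ) →
    + 4 * charPolyAt (p ℕ.^ m) (distMatrix (p ℕ.^ m)) t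
      ≡ (t + + 1 + + (p ℕ.^ (m ∸ 1))) ^ ((p ∸ 1) / 2)
        * (t + + 2) ^ (p ℕ.^ (m ∸ 1) ∸ 1)
        * (t + + 1) ^ ((p ∸ 1) ℕ.* (p ℕ.^ (m ∸ 1) ∸ 1))
        * (t - + (p ℕ.^ (m ∸ 1) ∸ 1)) ^ ((p ∸ 3) / 2)
        * ((+ 2 * t - (+ (p ℕ.^ m) + + 2 * + (p ℕ.^ (m ∸ 1)) - + 3)) ^ 2
           - (+ (p ℕ.^ (2 ℕ.* m)) + + 2 * + (p ℕ.^ m) - + 4 * + (p ℕ.^ (m ∸ 1)) + + 1))
mainTheorem13 p (suc m₁) p-prime 2∤p _ t with odd⇒double+1 p 2∤p
... | zero   , refl = ⊥-elim (¬prime[1] p-prime)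
... | suc h₀ , refl = begin
  + 4 * charPolyAt (p ℕ.* q) (distMatrix (p ℕ.* q)) t
    ≡⟨ closedForm q (ℕP.m^n>0 p m₁) (prime-power-divisor p p-prime (suc m₁)) ⟩
  spectrumPolynomial p q (p ℕ.* q ℕ.* (p ℕ.* q)) t
    ≡⟨ cong (λ N² → spectrumPolynomial p q N² t) (trans (cong (p ℕ.^_) (cong (suc m₁ ℕ.+_) (ℕP.+-identityʳ (suc m₁))))
                                                        (ℕP.^-distribˡ-+-* p (suc m₁) (suc m₁))) ⟨
  spectrumPolynomial p q (p ℕ.^ (2 ℕ.* suc m₁)) t
    ∎
  where
  open ≡-Reasoning
  q : ℕ
  q = p ℕ.^ m₁
  closedForm : ∀ q → 0 ℕ.< q → (∀ c → c ∣ p ℕ.* q → c ≡ 1 ⊎ p ∣ c) →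
    + 4 * charPolyAt (p ℕ.* q) (distMatrix (p ℕ.* q)) t ≡ spectrumPolynomial p q (p ℕ.* q ℕ.* (p ℕ.* q)) t
  closedForm (suc q₀) _ = ClosedForm.charPoly-closedForm h₀ q₀ t
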